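{- For $n\le 7$, the values $s_1(n,\# P_3,S_4)$ and $s_2(n,\# P_3,S_4)$ are as follows: for $n=1,2,3,4,5,6,7$, $s_1(n,\# P_3,S_4)$ equals $n-1,\ n-2,\ n,\ n,\ n-1,\ n,\ n$ respectively, and $s_2(n,\# P_3,S_4)$ equals $n-1,\ n-2,\ n,\ n,\ n,\ n-1,\ n$ respectively. For $n\ge 8$ and $i\in\{1,2\}$, $$s_i(n,\# P_3,S_4)=\begin{cases} n, & \text{if } n \text{ and } i \text{ have different parity},\\ n-1, & \text{if } n \text{ and } i \text{ have the same parity}.\end{cases}$$
   Context: For graphs $F$ and $H$, the $F$-saturation game on $n$ vertices is played by Max and Mini, who alternately claim previously unclaimed edges of $K_n$ so that the graph $G$ of claimed edges stays $F$-free; the game ends when $G$ is $F$-saturated (no further edge can be added without creating a copy of $F$). The $H$-score is the number of (not necessarily induced) subgraphs of the final $G$ isomorphic to $H$. Max maximizes, Mini minimizes the score; $s_1(n,\# H,F)$ is the optimal score when Max starts and $s_2(n,\# H,F)$ when Mini starts. $P_3$ is the path on 3 vertices and $S_4$ is the star on 4 vertices (so the game graph must keep maximum degree at most 2). -}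

module Defs where

open import Data.Bool using (Bool; true; false; _∧_; _∨_; not; if_then_else_)
open import Data.Nat using (ℕ; zero; suc; _+_; _∸_; _<ᵇ_; _⊔_; _⊓_)
open import Data.Nat.Combinatorics using (_C_)
open import Data.Fin using (Fin; toℕ; _≟_)
open import Data.List using (List; []; _∷_; concatMap; filterᵇ; length; allFin; map)
open import Data.Bool.ListAction using (any)
open import Data.Product using (_×_; _,_)
open import Relation.Nullary using (does)

-- An edge of K_n on vertex set Fin n, stored canonically as (u , v) with u < v.
Edge : ℕ → Set
Edge n = Fin n × Fin n

Graph : ℕ → Set
Graph n = List (Edge n)

allEdges : (n : ℕ) → List (Edge n)
allEdges n = concatMap (λ u → map (λ v → (u , v)) (filterᵇ (λ v → toℕ u <ᵇ toℕ v) (allFin n))) (allFin n)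

_==ᵉ_ : ∀ {n} → Edge n → Edge n → Bool
(a , b) ==ᵉ (c , d) = does (a ≟ c) ∧ does (b ≟ d)

incident : ∀ {n} → Fin n → Edge n → Bool
incident w (a , b) = does (w ≟ a) ∨ does (w ≟ b)

deg : ∀ {n} → Graph n → Fin n → ℕ
deg G w = length (filterᵇ (incident w) G)

_∈ᵍ_ : ∀ {n} → Edge n → Graph n → Bool
e ∈ᵍ G = any (e ==ᵉ_) G

-- G + e is S_4-free (S_4 = star K_{1,3}), i.e. both endpoints have degree < 2 in G.
-- (Adding e creates a copy of S_4 iff an endpoint of e already has degree ≥ 2.)
-- A move e is legal iff e is an edge of K_n not yet claimed and G + e stays S_4-free.
legal : ∀ {n} → Graph n → Edge n → Bool
legal G (a , b) = not ((a , b) ∈ᵍ G) ∧ (deg G a <ᵇ 2) ∧ (deg G b <ᵇ 2)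

legalMoves : ∀ {n} → Graph n → List (Edge n)
legalMoves {n} G = filterᵇ (legal G) (allEdges n)

shareVertex : ∀ {n} → Edge n → Edge n → Bool
shareVertex (a , b) f = incident a f ∨ incident b f

-- The P_3-score: the number of subgraphs of G isomorphic to P_3, i.e. the number of
-- unordered pairs {e , f} of distinct edges of G sharing a vertex.
p3Count : ∀ {n} → Graph n → ℕ
p3Count [] = 0
p3Count (e ∷ G) = length (filterᵇ (shareVertex e) G) + p3Count G

data Player : Set where
  Max Mini : Player

other : Player → Player
other Max = Mini
other Mini = Max

maxList : ℕ → List ℕ → ℕ
maxList x [] = x
maxList x (y ∷ ys) = x ⊔ maxList y ys

minList : ℕ → List ℕ → ℕ
minList x [] = x
minList x (y ∷ ys) = x ⊓ minList y ys

-- The fuel k bounds the number of remaining moves; with k = C(n,2) it never runs out,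
-- since every move claims a new edge of K_n.
value : ∀ {n} → ℕ → Player → Graph n → ℕ
value zero _ G = p3Count G
value (suc k) p G with legalMoves G
... | [] = p3Count G
... | e ∷ es with p
...   | Max  = maxList (value k Mini (e ∷ G)) (map (λ f → value k Mini (f ∷ G)) es)
...   | Mini = minList (value k Max (e ∷ G)) (map (λ f → value k Max (f ∷ G)) es)

s₁ : ℕ → ℕ
s₁ n = value {n} (n C 2) Max []

s₂ : ℕ → ℕ
s₂ n = value {n} (n C 2) Mini []

-- In a graph of maximum degree 2 every copy of P₃ is centred at a vertex of degree 2, so the
-- score is n minus the number of vertices of degree < 2. These are isolated vertices, ends of
-- components that are a single edge, and ends of longer paths; a legal move joins two of them,
-- and only their numbers (a , m , r) matter. So the saturation game is a game on such triples
-- with six kinds of moves, and optimal play of both players is captured by the final deficiency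
-- of that counter game. Beyond a small box this value is 2-periodic in each coordinate, so it is
-- an explicit table, certified by checking the Bellman equation on the box by evaluation and
-- transporting it by periodicity. Starting from n isolated vertices the table gives the claim.

module Submission where

open import Defs
open import Data.Bool using (Bool; true; false; _∧_; _∨_; not; if_then_else_; T)
open import Data.Bool.Properties using (∧-identityʳ; ∧-zeroʳ; ∨-zeroʳ; T-∧)
open import Data.Empty using (⊥-elim)
open import Data.Fin using (Fin; toℕ; _≟_) renaming (zero to fzero; suc to fsuc)
open import Data.Fin.Properties using (toℕ-injective) renaming (suc-injective to fsuc-injective)
open import Data.List using (List; []; _∷_; map; mapMaybe; length; filterᵇ; allFin)
open import Data.List.Properties using (map-∘; map-cong-local; filter-accept; filter-reject)
open import Data.List.Membership.Propositional using (_∈_; _∉_; lose; find)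
open import Data.List.Membership.Propositional.Properties
  using (∈-map⁺; ∈-map⁻; ∈-filter⁺; ∈-filter⁻; ∈-concatMap⁺; ∈-concatMap⁻; ∈-allFin)
open import Data.List.Relation.Binary.Subset.Propositional using (_⊆_)
open import Data.List.Relation.Unary.All as All using (All; []; _∷_)
open import Data.List.Relation.Unary.AllPairs using ([]; _∷_)
open import Data.List.Relation.Unary.Any using (here; there; any?)
open import Data.List.Relation.Unary.Unique.Propositional using (Unique)
open import Data.Maybe using (Maybe; just; nothing)
open import Data.Maybe.Properties using (≡-dec; just-injective)
open import Data.Nat using (ℕ; zero; suc; _+_; _*_; _∸_; _≤_; _<_; _⊔_; _⊓_; _<ᵇ_; _%_; z≤n; s≤s; s≤s⁻¹)
open import Data.Nat.Combinatorics using (_C_; nC1≡n; nCk+nC[k+1]≡[n+1]C[k+1])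
open import Data.Nat.Induction using (<-rec)
open import Data.Nat.Properties hiding (_≟_)
open import Data.Nat.Properties using () renaming (_≟_ to _≟ⁿ_)
open import Algebra.Properties.CommutativeSemigroup +-commutativeSemigroup
  using (x∙yz≈xz∙y; xy∙z≈xz∙y; xy∙z≈zy∙x; xy∙z≈y∙xz)
open import Data.Product using (_×_; _,_; proj₁; proj₂; ∃-syntax)
open import Data.Sum using (_⊎_; inj₁; inj₂)
open import Function using (_∘_)
open import Function.Bundles using (Equivalence)
open import Relation.Binary.Definitions using (DecidableEquality; tri<; tri≈; tri>)
open import Relation.Binary.PropositionalEquality
open import Relation.Nullary using (¬_; Dec; yes; no; does; contradiction)
open import Relation.Nullary.Decidable using (T?; dec-true; dec-false; toWitness)

best : Player → ℕ → List ℕ → ℕ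
best _    d []       = d
best Max  _ (x ∷ xs) = maxList x xs
best Mini _ (x ∷ xs) = minList x xs

best-default : ∀ p d e {x} {xs} → x ∈ xs → best p d xs ≡ best p e xs
best-default Max  _ _ {xs = _ ∷ _} _ = refl
best-default Mini _ _ {xs = _ ∷ _} _ = refl

∸-maxList : ∀ N x xs → N ∸ maxList x xs ≡ minList (N ∸ x) (map (N ∸_) xs)
∸-maxList N x []       = refl
∸-maxList N x (y ∷ ys) = trans (∸-distribˡ-⊔-⊓ N x (maxList y ys)) (cong ((N ∸ x) ⊓_) (∸-maxList N y ys))

∸-minList : ∀ N x xs → N ∸ minList x xs ≡ maxList (N ∸ x) (map (N ∸_) xs)
∸-minList N x []       = refl
∸-minList N x (y ∷ ys) = trans (∸-distribˡ-⊓-⊔ N x (minList y ys)) (cong ((N ∸ x) ⊔_) (∸-minList N y ys))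

∸-best : ∀ p N d xs → N ∸ best (other p) d xs ≡ best p (N ∸ d) (map (N ∸_) xs)
∸-best p    N d []       = refl
∸-best Max  N d (x ∷ xs) = ∸-minList N x xs
∸-best Mini N d (x ∷ xs) = ∸-maxList N x xs

maxList-∈ : ∀ x xs → maxList x xs ∈ x ∷ xs
maxList-∈ x []       = here refl
maxList-∈ x (y ∷ ys) with ≤-total x (maxList y ys)
... | inj₁ x≤ rewrite m≤n⇒m⊔n≡n x≤ = there (maxList-∈ y ys)
... | inj₂ x≥ rewrite m≥n⇒m⊔n≡m x≥ = here refl

≤-maxList : ∀ x xs {z} → z ∈ x ∷ xs → z ≤ maxList x xs
≤-maxList x []       (here refl) = ≤-refl
≤-maxList x (y ∷ ys) (here refl) = m≤m⊔n x _
≤-maxList x (y ∷ ys) (there z∈) = ≤-trans (≤-maxList y ys z∈) (m≤n⊔m x _)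

minList-∈ : ∀ x xs → minList x xs ∈ x ∷ xs
minList-∈ x []       = here refl
minList-∈ x (y ∷ ys) with ≤-total x (minList y ys)
... | inj₁ x≤ rewrite m≤n⇒m⊓n≡m x≤ = here refl
... | inj₂ x≥ rewrite m≥n⇒m⊓n≡n x≥ = there (minList-∈ y ys)

minList-≤ : ∀ x xs {z} → z ∈ x ∷ xs → minList x xs ≤ z
minList-≤ x []       (here refl) = ≤-refl
minList-≤ x (y ∷ ys) (here refl) = m⊓n≤m x _
minList-≤ x (y ∷ ys) (there z∈) = ≤-trans (m⊓n≤n x _) (minList-≤ y ys z∈)

best-cong : ∀ p {d e xs ys} → d ≡ e → xs ⊆ ys → ys ⊆ xs → best p d xs ≡ best p e ys
best-cong p    {xs = []}     {[]}     d≡e _     _     = d≡e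
best-cong p    {xs = []}     {y ∷ ys} _   _     ys⊆xs with () ← ys⊆xs (here refl)
best-cong p    {xs = x ∷ xs} {[]}     _   xs⊆ys _     with () ← xs⊆ys (here refl)
best-cong Max  {xs = x ∷ xs} {y ∷ ys} _   xs⊆ys ys⊆xs =
  ≤-antisym (≤-maxList y ys (xs⊆ys (maxList-∈ x xs))) (≤-maxList x xs (ys⊆xs (maxList-∈ y ys)))
best-cong Mini {xs = x ∷ xs} {y ∷ ys} _   xs⊆ys ys⊆xs =
  ≤-antisym (minList-≤ x xs (ys⊆xs (minList-∈ y ys))) (minList-≤ y ys (xs⊆ys (minList-∈ x xs)))

value-suc : ∀ {n} k p (G : Graph n) →
  value (suc k) p G ≡ best p (p3Count G) (map (λ f → value k (other p) (f ∷ G)) (legalMoves G))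
value-suc k p G with legalMoves G
... | []    = refl
... | _ ∷ _ with p
...   | Max  = refl
...   | Mini = refl

∈-mapMaybe⁺ : ∀ {A B : Set} (f : A → Maybe B) {x y} {xs} → x ∈ xs → f x ≡ just y → y ∈ mapMaybe f xs
∈-mapMaybe⁺ f {xs = x ∷ _} (here refl) fx rewrite fx = here refl
∈-mapMaybe⁺ f {xs = z ∷ _} (there x∈) fx with f z
... | just _  = there (∈-mapMaybe⁺ f x∈ fx)
... | nothing = ∈-mapMaybe⁺ f x∈ fx

∈-mapMaybe⁻ : ∀ {A B : Set} (f : A → Maybe B) {y} xs → y ∈ mapMaybe f xs → ∃[ x ] x ∈ xs × f x ≡ just y
∈-mapMaybe⁻ f (x ∷ xs) y∈ with f x in fx
∈-mapMaybe⁻ f (x ∷ xs) (here refl) | just _ = x , here refl , fx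
∈-mapMaybe⁻ f (x ∷ xs) (there y∈)  | just _ with z , z∈ , fz ← ∈-mapMaybe⁻ f xs y∈ = z , there z∈ , fz
∈-mapMaybe⁻ f (x ∷ xs) y∈          | nothing with z , z∈ , fz ← ∈-mapMaybe⁻ f xs y∈ = z , there z∈ , fz

true-or-false : ∀ b → b ≡ true ⊎ b ≡ false
true-or-false true  = inj₁ refl
true-or-false false = inj₂ refl

indicator : Bool → ℕ
indicator true  = 1
indicator false = 0

countOn : ∀ {A : Set} → (A → Bool) → List A → ℕ
countOn P []       = 0
countOn P (x ∷ xs) = indicator (P x) + countOn P xs

count : ∀ {n} → (Fin n → Bool) → ℕ
count {zero}  P = 0
count {suc n} P = indicator (P fzero) + count (P ∘ fsuc)

countOn-map : ∀ {A B : Set} (P : B → Bool) (f : A → B) xs → countOn P (map f xs) ≡ countOn (P ∘ f) xs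
countOn-map P f []       = refl
countOn-map P f (x ∷ xs) = cong (indicator (P (f x)) +_) (countOn-map P f xs)

countOn-≤-length : ∀ {A : Set} (P : A → Bool) xs → countOn P xs ≤ length xs
countOn-≤-length P []       = z≤n
countOn-≤-length P (x ∷ xs) with P x
... | true  = s≤s (countOn-≤-length P xs)
... | false = m≤n⇒m≤1+n (countOn-≤-length P xs)

countOn-cong : ∀ {A : Set} {P Q : A → Bool} xs → (∀ {v} → v ∈ xs → P v ≡ Q v) → countOn P xs ≡ countOn Q xs
countOn-cong []       _     = refl
countOn-cong (x ∷ xs) P≗Q = cong₂ _+_ (cong indicator (P≗Q (here refl))) (countOn-cong xs (P≗Q ∘ there))

count-cong : ∀ {n} {P Q : Fin n → Bool} → (∀ v → P v ≡ Q v) → count P ≡ count Q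
count-cong {zero}  _   = refl
count-cong {suc n} P≗Q = cong₂ _+_ (cong indicator (P≗Q fzero)) (count-cong (P≗Q ∘ fsuc))

count-pos : ∀ {n} (P : Fin n → Bool) → 0 < count P → ∃[ v ] P v ≡ true
count-pos {suc n} P pos with P fzero in P0
... | true  = fzero , P0
... | false with v , Pv ← count-pos (P ∘ fsuc) pos = fsuc v , Pv

count-differ-at : ∀ {n} (P Q : Fin n → Bool) w → (∀ v → v ≢ w → P v ≡ Q v) →
  count P + indicator (Q w) ≡ count Q + indicator (P w)
count-differ-at {suc n} P Q fzero agree = begin
  indicator (P fzero) + count (P ∘ fsuc) + indicator (Q fzero) ≡⟨ cong (λ c → indicator (P fzero) + c + _) rest ⟩
  indicator (P fzero) + count (Q ∘ fsuc) + indicator (Q fzero) ≡⟨ xy∙z≈zy∙x (indicator (P fzero)) _ _ ⟩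
  indicator (Q fzero) + count (Q ∘ fsuc) + indicator (P fzero) ∎
  where
  open ≡-Reasoning
  rest : count (P ∘ fsuc) ≡ count (Q ∘ fsuc)
  rest = count-cong (λ v → agree (fsuc v) λ ())
count-differ-at {suc n} P Q (fsuc w) agree = begin
  indicator (P fzero) + count (P ∘ fsuc) + indicator (Q (fsuc w))   ≡⟨ +-assoc (indicator (P fzero)) _ _ ⟩
  indicator (P fzero) + (count (P ∘ fsuc) + indicator (Q (fsuc w))) ≡⟨ cong₂ _+_ (cong indicator (agree fzero λ ())) rest ⟩
  indicator (Q fzero) + (count (Q ∘ fsuc) + indicator (P (fsuc w))) ≡⟨ +-assoc (indicator (Q fzero)) _ _ ⟨
  indicator (Q fzero) + count (Q ∘ fsuc) + indicator (P (fsuc w))   ∎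
  where
  open ≡-Reasoning
  rest = count-differ-at (P ∘ fsuc) (Q ∘ fsuc) w (λ v v≢w → agree (fsuc v) (v≢w ∘ fsuc-injective))

count-differ-on : ∀ {n} (P Q : Fin n → Bool) S → Unique S → (∀ v → v ∉ S → P v ≡ Q v) →
  count P + countOn Q S ≡ count Q + countOn P S
count-differ-on P Q []      _                agree = cong (_+ 0) (count-cong λ v → agree v λ ())
count-differ-on {n} P Q (w ∷ S) (w∉S ∷ unique) agree = begin
  count P + (indicator (Q w) + countOn Q S) ≡⟨ cong (λ c → count P + (indicator (Q w) + c)) (countOn-cong S Q≗H) ⟩
  count P + (indicator (Q w) + countOn H S) ≡⟨ x∙yz≈xz∙y (count P) (indicator (Q w)) _ ⟩
  count P + countOn H S + indicator (Q w)   ≡⟨ cong (_+ indicator (Q w)) (count-differ-on P H S unique agree-H) ⟩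
  count H + countOn P S + indicator (Q w)   ≡⟨ xy∙z≈xz∙y (count H) _ (indicator (Q w)) ⟩
  count H + indicator (Q w) + countOn P S   ≡⟨ cong (_+ countOn P S) (count-differ-at H Q w H≗Q) ⟩
  count Q + indicator (H w) + countOn P S   ≡⟨ cong (λ b → count Q + indicator b + countOn P S) H-at-w ⟩
  count Q + indicator (P w) + countOn P S   ≡⟨ +-assoc (count Q) _ _ ⟩
  count Q + (indicator (P w) + countOn P S) ∎
  where
  open ≡-Reasoning
  H : Fin n → Bool
  H v = if does (v ≟ w) then P v else Q v
  H-at-w : H w ≡ P w
  H-at-w rewrite dec-true (w ≟ w) refl = refl
  H≗Q : ∀ v → v ≢ w → H v ≡ Q v
  H≗Q v v≢w rewrite dec-false (v ≟ w) v≢w = refl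
  Q≗H : ∀ {v} → v ∈ S → Q v ≡ H v
  Q≗H {v} v∈S = sym (H≗Q v λ { refl → All.lookup w∉S v∈S refl })
  agree-H : ∀ v → v ∉ S → P v ≡ H v
  agree-H v v∉S with v ≟ w
  ... | yes refl = refl
  ... | no v≢w   = agree v λ { (here v≡w) → v≢w v≡w ; (there v∈S) → v∉S v∈S }

_∈?_ : ∀ {n} (v : Fin n) S → Dec (v ∈ S)
v ∈? S = any? (v ≟_) S

_∖_ : ∀ {n} → (Fin n → Bool) → List (Fin n) → Fin n → Bool
(P ∖ S) v = P v ∧ not (does (v ∈? S))

count-∖ : ∀ {n} (P : Fin n → Bool) S → Unique S → count P ≡ count (P ∖ S) + countOn P S
count-∖ P S unique = begin
  count P                           ≡⟨ +-identityʳ (count P) ⟨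
  count P + 0                       ≡⟨ cong (count P +_) (countOn-none S inside) ⟨
  count P + countOn (P ∖ S) S       ≡⟨ count-differ-on P (P ∖ S) S unique outside ⟩
  count (P ∖ S) + countOn P S       ∎
  where
  open ≡-Reasoning
  inside : ∀ {v} → v ∈ S → (P ∖ S) v ≡ P v ∧ false
  inside {v} v∈S = cong (λ b → P v ∧ not b) (dec-true (v ∈? S) v∈S)
  countOn-none : ∀ T → (∀ {v} → v ∈ T → (P ∖ S) v ≡ P v ∧ false) → countOn (P ∖ S) T ≡ 0
  countOn-none []      _    = refl
  countOn-none (v ∷ T) none rewrite none (here refl) | ∧-zeroʳ (P v) = countOn-none T (none ∘ there)
  outside : ∀ v → v ∉ S → P v ≡ (P ∖ S) v
  outside v v∉S = sym (trans (cong (λ b → P v ∧ not b) (dec-false (v ∈? S) v∉S)) (∧-identityʳ (P v)))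

countOn-≤-count : ∀ {n} (P : Fin n → Bool) S → Unique S → countOn P S ≤ count P
countOn-≤-count P S unique = subst (countOn P S ≤_) (sym (count-∖ P S unique)) (m≤n+m _ _)

count-avoid : ∀ {n} (P : Fin n → Bool) S → Unique S → length S < count P → ∃[ v ] P v ≡ true × v ∉ S
count-avoid P S unique S<P = avoid (count-pos (P ∖ S) positive)
  where
  positive : 0 < count (P ∖ S)
  positive = +-cancelʳ-< (length S) 0 _ (<-≤-trans S<P (begin
    count P                      ≡⟨ count-∖ P S unique ⟩
    count (P ∖ S) + countOn P S  ≤⟨ +-monoʳ-≤ (count (P ∖ S)) (countOn-≤-length P S) ⟩
    count (P ∖ S) + length S     ∎))
    where open ≤-Reasoning
  avoid : ∃[ v ] P v ∧ not (does (v ∈? S)) ≡ true → ∃[ v ] P v ≡ true × v ∉ S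
  avoid (v , Pv) with P v in Pv≡true | v ∈? S
  ... | true  | no v∉S = v , Pv≡true , v∉S
  ... | true  | yes _  = contradiction Pv λ ()
  ... | false | _      = contradiction Pv λ ()

count-true : ∀ n → count {n} (λ _ → true) ≡ n
count-true zero    = refl
count-true (suc n) = cong suc (count-true n)

count-false : ∀ n → count {n} (λ _ → false) ≡ 0
count-false zero    = refl
count-false (suc n) = count-false n

length-filter-∨ : ∀ {A : Set} (P Q : A → Bool) xs → (∀ {x} → x ∈ xs → P x ≡ true → Q x ≡ false) →
  length (filterᵇ (λ x → P x ∨ Q x) xs) ≡ length (filterᵇ P xs) + length (filterᵇ Q xs)
length-filter-∨ P Q []       _        = refl
length-filter-∨ P Q (x ∷ xs) disjoint with P x in Px | Q x in Qx
... | true  | true  = contradiction (trans (sym (disjoint (here refl) Px)) Qx) λ ()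
... | true  | false = cong suc (length-filter-∨ P Q xs (disjoint ∘ there))
... | false | true  = trans (cong suc (length-filter-∨ P Q xs (disjoint ∘ there))) (sym (+-suc _ _))
... | false | false = length-filter-∨ P Q xs (disjoint ∘ there)

extend-periodic : ∀ {P : ℕ → Set} t b → 2 + t ≤ b →
  (∀ x → x < b → P x) → (∀ x → t ≤ x → P x → P (2 + x)) → ∀ x → P x
extend-periodic {P} t b 2+t≤b base next = <-rec P go
  where
  above : ∀ x → 2 + t ≤ x → (∀ {y} → y < x → P y) → P x
  above (suc (suc y)) (s≤s (s≤s t≤y)) earlier = next y t≤y (earlier (m<n⇒m<1+n (n<1+n y)))

  go : ∀ x → (∀ {y} → y < x → P y) → P x
  go x earlier with x <? b
  ... | yes x<b = base x x<b
  ... | no x≮b  = above x (≤-trans 2+t≤b (≮⇒≥ x≮b)) earlier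

-- The counter game

-- (a , m , r): isolated vertices, components that are a single edge, paths with at least two edges.
Shape : Set
Shape = ℕ × ℕ × ℕ

size : Shape → ℕ
size (a , m , r) = a + m + r

deficiency : Shape → ℕ
deficiency (a , m , r) = a + m * 2 + r * 2

data Kind : Set where
  isolated k₂-end path-end : Kind

all-kinds : ∀ {P : Kind → Set} → P isolated → P k₂-end → P path-end → ∀ κ → P κ
all-kinds i k l isolated = i
all-kinds i k l k₂-end   = k
all-kinds i k l path-end = l

_≟ᵏ_ : DecidableEquality Kind
isolated ≟ᵏ isolated = yes refl
k₂-end   ≟ᵏ k₂-end   = yes refl
path-end ≟ᵏ path-end = yes refl
isolated ≟ᵏ k₂-end   = no λ ()
isolated ≟ᵏ path-end = no λ ()
k₂-end   ≟ᵏ isolated = no λ ()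
k₂-end   ≟ᵏ path-end = no λ ()
path-end ≟ᵏ isolated = no λ ()
path-end ≟ᵏ k₂-end   = no λ ()

_is_ : Maybe Kind → Kind → Bool
k is κ = does (≡-dec _≟ᵏ_ k (just κ))

is-just : ∀ {k κ} → k is κ ≡ true → k ≡ just κ
is-just {k} {κ} eq with ≡-dec _≟ᵏ_ k (just κ)
... | yes k≡κ = k≡κ
... | no _    = contradiction eq λ ()

tally : List (Maybe Kind) → Kind → ℕ
tally ks κ = countOn (_is κ) ks

data Move : Set where
  iso-iso iso-k₂ iso-path k₂-k₂ k₂-path path-path : Move

moves : List Move
moves = iso-iso ∷ iso-k₂ ∷ iso-path ∷ k₂-k₂ ∷ k₂-path ∷ path-path ∷ []

∈-moves : ∀ μ → μ ∈ moves
∈-moves iso-iso   = here refl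
∈-moves iso-k₂    = there (here refl)
∈-moves iso-path  = there (there (here refl))
∈-moves k₂-k₂     = there (there (there (here refl)))
∈-moves k₂-path   = there (there (there (there (here refl))))
∈-moves path-path = there (there (there (there (there (here refl)))))

-- A move joins two vertices of degree < 2, named by their kinds. Joining the two ends of one
-- path closes a cycle, which changes the shape exactly as joining two paths does.
data _⊢_⟶_ : Move → Shape → Shape → Set where
  iso-iso   : ∀ {a m r} → iso-iso   ⊢ (2 + a , m , r)     ⟶ (a , 1 + m , r)
  iso-k₂    : ∀ {a m r} → iso-k₂    ⊢ (1 + a , 1 + m , r) ⟶ (a , m , 1 + r)
  iso-path  : ∀ {a m r} → iso-path  ⊢ (1 + a , m , 1 + r) ⟶ (a , m , 1 + r)
  k₂-k₂     : ∀ {a m r} → k₂-k₂     ⊢ (a , 2 + m , r)     ⟶ (a , m , 1 + r)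
  k₂-path   : ∀ {a m r} → k₂-path   ⊢ (a , 1 + m , 1 + r) ⟶ (a , m , 1 + r)
  path-path : ∀ {a m r} → path-path ⊢ (a , m , 1 + r)     ⟶ (a , m , r)

step : Move → Shape → Maybe Shape
step iso-iso   (suc (suc a) , m , r) = just (a , suc m , r)
step iso-k₂    (suc a , suc m , r)   = just (a , m , suc r)
step iso-path  (suc a , m , suc r)   = just (a , m , suc r)
step k₂-k₂     (a , suc (suc m) , r) = just (a , m , suc r)
step k₂-path   (a , suc m , suc r)   = just (a , m , suc r)
step path-path (a , m , suc r)       = just (a , m , r)
step _         _                     = nothing

step-complete : ∀ {μ s t} → μ ⊢ s ⟶ t → step μ s ≡ just t
step-complete iso-iso   = refl
step-complete iso-k₂    = refl
step-complete iso-path  = refl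
step-complete k₂-k₂     = refl
step-complete k₂-path   = refl
step-complete path-path = refl

step-sound : ∀ μ s {t} → step μ s ≡ just t → μ ⊢ s ⟶ t
step-sound iso-iso   (suc (suc a) , m , r) refl = iso-iso
step-sound iso-k₂    (suc a , suc m , r)   refl = iso-k₂
step-sound iso-path  (suc a , m , suc r)   refl = iso-path
step-sound k₂-k₂     (a , suc (suc m) , r) refl = k₂-k₂
step-sound k₂-path   (a , suc m , suc r)   refl = k₂-path
step-sound path-path (a , m , suc r)       refl = path-path
step-sound iso-iso   (zero , _ , _)        ()
step-sound iso-iso   (suc zero , _ , _)    ()
step-sound iso-k₂    (zero , _ , _)        ()
step-sound iso-k₂    (suc _ , zero , _)    ()
step-sound iso-path  (zero , _ , _)        ()
step-sound iso-path  (suc _ , _ , zero)    ()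
step-sound k₂-k₂     (_ , zero , _)        ()
step-sound k₂-k₂     (_ , suc zero , _)    ()
step-sound k₂-path   (_ , zero , _)        ()
step-sound k₂-path   (_ , suc _ , zero)    ()
step-sound path-path (_ , _ , zero)        ()

successors : Shape → List Shape
successors s = mapMaybe (λ μ → step μ s) moves

∈-successors⁺ : ∀ {μ s t} → μ ⊢ s ⟶ t → t ∈ successors s
∈-successors⁺ {μ} {s} st = ∈-mapMaybe⁺ (λ ν → step ν s) (∈-moves μ) (step-complete st)

∈-successors⁻ : ∀ s {t} → t ∈ successors s → ∃[ μ ] μ ⊢ s ⟶ t
∈-successors⁻ s t∈ with μ , _ , st ← ∈-mapMaybe⁻ (λ ν → step ν s) moves t∈ = μ , step-sound μ s st

⟶-size : ∀ {μ a m r a′ m′ r′} → μ ⊢ (a , m , r) ⟶ (a′ , m′ , r′) → suc (a′ + m′ + r′) ≡ a + m + r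
⟶-size (iso-iso   {a} {m} {r}) = cong suc (cong (_+ r) (+-suc a m))
⟶-size (iso-k₂    {a} {m} {r}) = cong suc (trans (+-suc (a + m) r) (cong (_+ r) (sym (+-suc a m))))
⟶-size iso-path                = refl
⟶-size (k₂-k₂     {a} {m} {r}) =
  trans (cong suc (+-suc (a + m) r)) (cong (_+ r) (sym (trans (+-suc a (suc m)) (cong suc (+-suc a m)))))
⟶-size (k₂-path   {a} {m} {r}) = cong (_+ suc r) (sym (+-suc a m))
⟶-size (path-path {a} {m} {r}) = sym (+-suc (a + m) r)

⟶-drop : ∀ {μ a m r a′ m′ r′} → μ ⊢ (a , m , r) ⟶ (a′ , m′ , r′) →
  a ≤ 2 + a′ × m ≤ 2 + m′ × r ≤ 1 + r′
⟶-drop (iso-iso   {a} {m} {r}) = ≤-refl , m≤n+m m 3 , m≤n+m r 1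
⟶-drop (iso-k₂    {a} {m} {r}) = m≤n+m (suc a) 1 , m≤n+m (suc m) 1 , m≤n+m r 2
⟶-drop (iso-path  {a} {m} {r}) = m≤n+m (suc a) 1 , m≤n+m m 2 , m≤n+m (suc r) 1
⟶-drop (k₂-k₂     {a} {m} {r}) = m≤n+m a 2 , ≤-refl , m≤n+m r 2
⟶-drop (k₂-path   {a} {m} {r}) = m≤n+m a 2 , m≤n+m (suc m) 1 , m≤n+m (suc r) 1
⟶-drop (path-path {a} {m} {r}) = m≤n+m a 2 , m≤n+m m 2 , ≤-refl

shapeCensus : Shape → Kind → ℕ
shapeCensus (a , m , r) isolated = a
shapeCensus (a , m , r) k₂-end   = m * 2
shapeCensus (a , m , r) path-end = r * 2

-- The kinds, before and after the move, of the vertices whose kind changes: the two joined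
-- vertices, then the other ends of joined single-edge components; nothing marks degree 2.
consumed produced : Move → List (Maybe Kind)
consumed iso-iso   = just isolated ∷ just isolated ∷ []
consumed iso-k₂    = just isolated ∷ just k₂-end ∷ just k₂-end ∷ []
consumed iso-path  = just isolated ∷ just path-end ∷ []
consumed k₂-k₂     = just k₂-end ∷ just k₂-end ∷ just k₂-end ∷ just k₂-end ∷ []
consumed k₂-path   = just k₂-end ∷ just path-end ∷ just k₂-end ∷ []
consumed path-path = just path-end ∷ just path-end ∷ []
produced iso-iso   = just k₂-end ∷ just k₂-end ∷ []
produced iso-k₂    = just path-end ∷ nothing ∷ just path-end ∷ []
produced iso-path  = just path-end ∷ nothing ∷ []
produced k₂-k₂     = nothing ∷ nothing ∷ just path-end ∷ just path-end ∷ []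
produced k₂-path   = nothing ∷ nothing ∷ just path-end ∷ []
produced path-path = nothing ∷ nothing ∷ []

-- The new edge forms a P₃ with every edge already at its ends.
gain : Move → ℕ
gain iso-iso   = 0
gain iso-k₂    = 1
gain iso-path  = 1
gain k₂-k₂     = 2
gain k₂-path   = 2
gain path-path = 2

moveOf : Kind → Kind → Move
moveOf isolated isolated = iso-iso
moveOf isolated k₂-end   = iso-k₂
moveOf isolated path-end = iso-path
moveOf k₂-end   isolated = iso-k₂
moveOf k₂-end   k₂-end   = k₂-k₂
moveOf k₂-end   path-end = k₂-path
moveOf path-end isolated = iso-path
moveOf path-end k₂-end   = k₂-path
moveOf path-end path-end = path-path

moveOf-comm : ∀ κ κ′ → moveOf κ κ′ ≡ moveOf κ′ κ
moveOf-comm isolated isolated = refl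
moveOf-comm isolated k₂-end   = refl
moveOf-comm isolated path-end = refl
moveOf-comm k₂-end   isolated = refl
moveOf-comm k₂-end   k₂-end   = refl
moveOf-comm k₂-end   path-end = refl
moveOf-comm path-end isolated = refl
moveOf-comm path-end k₂-end   = refl
moveOf-comm path-end path-end = refl

⟶-census : ∀ {μ s t} → μ ⊢ s ⟶ t →
  ∀ κ → tally (consumed μ) κ + shapeCensus t κ ≡ tally (produced μ) κ + shapeCensus s κ
⟶-census iso-iso   = all-kinds refl refl refl
⟶-census iso-k₂    = all-kinds refl refl refl
⟶-census iso-path  = all-kinds refl refl refl
⟶-census k₂-k₂     = all-kinds refl refl refl
⟶-census k₂-path   = all-kinds refl refl refl
⟶-census path-path = all-kinds refl refl refl

+-suc² : ∀ x y → x + (2 + y) ≡ 2 + (x + y)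
+-suc² x y = trans (+-suc x (suc y)) (cong suc (+-suc x y))

⟶-deficiency : ∀ {μ s t} → μ ⊢ s ⟶ t → deficiency s ≡ gain μ + deficiency t
⟶-deficiency (iso-iso   {a} {m} {r}) = sym (cong (_+ r * 2) (+-suc² a (m * 2)))
⟶-deficiency (iso-k₂    {a} {m} {r}) = cong suc (trans (cong (_+ r * 2) (+-suc² a (m * 2))) (sym (+-suc² (a + m * 2) (r * 2))))
⟶-deficiency iso-path                = refl
⟶-deficiency (k₂-k₂     {a} {m} {r}) = trans (cong (_+ r * 2) (trans (+-suc² a (2 + m * 2)) (cong (2 +_) (+-suc² a (m * 2)))))
                                              (sym (cong (2 +_) (+-suc² (a + m * 2) (r * 2))))
⟶-deficiency (k₂-path   {a} {m} {r}) = cong (_+ (2 + r * 2)) (+-suc² a (m * 2))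
⟶-deficiency (path-path {a} {m} {r}) = +-suc² (a + m * 2) (r * 2)

⟶-deterministic : ∀ {μ s t t′} → μ ⊢ s ⟶ t → μ ⊢ s ⟶ t′ → t ≡ t′
⟶-deterministic iso-iso   iso-iso   = refl
⟶-deterministic iso-k₂    iso-k₂    = refl
⟶-deterministic iso-path  iso-path  = refl
⟶-deterministic k₂-k₂     k₂-k₂     = refl
⟶-deterministic k₂-path   k₂-path   = refl
⟶-deterministic path-path path-path = refl

Enabled : Move → Shape → Set
Enabled μ s = ∀ κ → tally (consumed μ) κ ≤ shapeCensus s κ

⟶-enabled : ∀ μ s → Enabled μ s → ∃[ t ] μ ⊢ s ⟶ t
⟶-enabled iso-iso   (suc (suc a) , m , r)    _ = _ , iso-iso
⟶-enabled iso-k₂    (suc a , suc m , r)      _ = _ , iso-k₂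
⟶-enabled iso-path  (suc a , m , suc r)      _ = _ , iso-path
⟶-enabled k₂-k₂     (a , suc (suc m) , r)    _ = _ , k₂-k₂
⟶-enabled k₂-path   (a , suc m , suc r)      _ = _ , k₂-path
⟶-enabled path-path (a , m , suc r)          _ = _ , path-path
⟶-enabled iso-iso   (zero , m , r)           h = contradiction (h isolated) λ ()
⟶-enabled iso-iso   (suc zero , m , r)       h = contradiction (h isolated) λ { (s≤s ()) }
⟶-enabled iso-k₂    (zero , m , r)           h = contradiction (h isolated) λ ()
⟶-enabled iso-k₂    (suc a , zero , r)       h = contradiction (h k₂-end) λ ()
⟶-enabled iso-path  (zero , m , r)           h = contradiction (h isolated) λ ()
⟶-enabled iso-path  (suc a , m , zero)       h = contradiction (h path-end) λ ()
⟶-enabled k₂-k₂     (a , zero , r)           h = contradiction (h k₂-end) λ ()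
⟶-enabled k₂-k₂     (a , suc zero , r)       h = contradiction (h k₂-end) λ { (s≤s (s≤s ())) }
⟶-enabled k₂-path   (a , zero , r)           h = contradiction (h k₂-end) λ ()
⟶-enabled k₂-path   (a , suc m , zero)       h = contradiction (h path-end) λ ()
⟶-enabled path-path (a , m , zero)           h = contradiction (h path-end) λ ()

reduce : ℕ → ℕ → ℕ
reduce t x = x ⊓ t + (x ∸ t) % 2

reduce-periodic : ∀ {t x} → t ≤ x → reduce t (2 + x) ≡ reduce t x
reduce-periodic {t} {x} t≤x = cong₂ _+_
  (trans (m≥n⇒m⊓n≡n (≤-trans t≤x (m≤n+m x 2))) (sym (m≥n⇒m⊓n≡n t≤x)))
  (cong (_% 2) (+-∸-assoc 2 t≤x))

-- The final deficiency under optimal play in reduced coordinates (0 where not listed), found by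
-- solving the counter game; bellman-box checks it on a box and bellman extends it by periodicity.
deficiencyTable : Player → ℕ → ℕ → ℕ → ℕ
deficiencyTable Max  0 1 0 = 2
deficiencyTable Max  0 3 0 = 2
deficiencyTable Max  0 5 0 = 2
deficiencyTable Max  1 0 0 = 1
deficiencyTable Max  1 2 0 = 1
deficiencyTable Max  1 4 0 = 1
deficiencyTable Max  1 6 0 = 1
deficiencyTable Max  2 0 0 = 2
deficiencyTable Max  2 0 1 = 1
deficiencyTable Max  3 1 1 = 1
deficiencyTable Max  4 1 0 = 1
deficiencyTable Max  4 3 0 = 1
deficiencyTable Max  5 0 0 = 1
deficiencyTable Max  5 2 0 = 1
deficiencyTable Max  5 4 0 = 1
deficiencyTable Max  6 0 1 = 1
deficiencyTable Max  6 1 0 = 1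
deficiencyTable Max  7 1 1 = 1
deficiencyTable Max  8 0 1 = 1
deficiencyTable Max  8 1 0 = 1
deficiencyTable Max  9 0 0 = 1
deficiencyTable Max  9 0 2 = 1
deficiencyTable Max  9 1 1 = 1
deficiencyTable Max  9 2 0 = 1
deficiencyTable Mini 0 1 0 = 2
deficiencyTable Mini 0 1 1 = 2
deficiencyTable Mini 0 3 1 = 2
deficiencyTable Mini 0 5 1 = 2
deficiencyTable Mini 1 0 0 = 1
deficiencyTable Mini 1 0 1 = 1
deficiencyTable Mini 1 2 1 = 1
deficiencyTable Mini 1 4 1 = 1
deficiencyTable Mini 1 6 1 = 1
deficiencyTable Mini 2 0 0 = 2
deficiencyTable Mini 2 0 1 = 2
deficiencyTable Mini 2 0 2 = 1
deficiencyTable Mini 2 1 1 = 1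
deficiencyTable Mini 2 2 0 = 2
deficiencyTable Mini 2 4 0 = 2
deficiencyTable Mini 2 6 0 = 2
deficiencyTable Mini 3 0 1 = 1
deficiencyTable Mini 3 1 0 = 1
deficiencyTable Mini 3 1 2 = 1
deficiencyTable Mini 3 2 1 = 1
deficiencyTable Mini 3 3 0 = 1
deficiencyTable Mini 3 5 0 = 1
deficiencyTable Mini 4 1 1 = 1
deficiencyTable Mini 4 2 0 = 1
deficiencyTable Mini 4 3 1 = 1
deficiencyTable Mini 5 0 1 = 1
deficiencyTable Mini 5 2 1 = 1
deficiencyTable Mini 5 4 1 = 1
deficiencyTable Mini 6 0 0 = 1
deficiencyTable Mini 6 0 2 = 1
deficiencyTable Mini 6 1 1 = 1
deficiencyTable Mini 6 2 0 = 1
deficiencyTable Mini 7 0 1 = 1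
deficiencyTable Mini 7 1 0 = 1
deficiencyTable Mini 7 1 2 = 1
deficiencyTable Mini 7 2 1 = 1
deficiencyTable Mini 7 3 0 = 1
deficiencyTable Mini 8 0 0 = 1
deficiencyTable Mini 8 0 2 = 1
deficiencyTable Mini 8 1 1 = 1
deficiencyTable Mini 8 2 0 = 1
deficiencyTable Mini 9 0 1 = 1
deficiencyTable Mini 9 0 3 = 1
deficiencyTable Mini 9 1 0 = 1
deficiencyTable Mini 9 1 2 = 1
deficiencyTable Mini 9 2 1 = 1
deficiencyTable Mini 9 3 0 = 1
deficiencyTable _    _ _ _ = 0

finalDeficiency : Player → Shape → ℕ
finalDeficiency p (a , m , r) = deficiencyTable p (reduce 8 a) (reduce 5 m) (reduce 4 r)

-- Max maximises the score, that is, minimises the deficiency: hence other p.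
bellmanValue : Player → Shape → ℕ
bellmanValue p s = best (other p) (deficiency s) (map (finalDeficiency (other p)) (successors s))

Bellman : Player → Shape → Set
Bellman p s = bellmanValue p s ≡ finalDeficiency p s

bellman? : ∀ p s → Dec (Bellman p s)
bellman? p s = bellmanValue p s ≟ⁿ finalDeficiency p s

BellmanBox : Player → Set
BellmanBox p = ∀ {a} → a < 12 → ∀ {m} → m < 9 → ∀ {r} → r < 7 → Bellman p (a , m , r)

bellmanBox? : ∀ p → Dec (BellmanBox p)
bellmanBox? p = allUpTo? (λ a → allUpTo? (λ m → allUpTo? (λ r → bellman? p (a , m , r)) 7) 9) 12

bellman-box : ∀ p → BellmanBox p
bellman-box Max  = toWitness {a? = bellmanBox? Max} _
bellman-box Mini = toWitness {a? = bellmanBox? Mini} _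

shiftᵃ shiftᵐ shiftʳ : Shape → Shape
shiftᵃ (a , m , r) = (2 + a , m , r)
shiftᵐ (a , m , r) = (a , 2 + m , r)
shiftʳ (a , m , r) = (a , m , 2 + r)

successors-shiftᵃ : ∀ a m r → successors (4 + a , m , r) ≡ map shiftᵃ (successors (2 + a , m , r))
successors-shiftᵃ a zero          zero    = refl
successors-shiftᵃ a zero          (suc r) = refl
successors-shiftᵃ a (suc zero)    zero    = refl
successors-shiftᵃ a (suc zero)    (suc r) = refl
successors-shiftᵃ a (suc (suc m)) zero    = refl
successors-shiftᵃ a (suc (suc m)) (suc r) = refl

successors-shiftᵐ : ∀ a m r → successors (a , 4 + m , r) ≡ map shiftᵐ (successors (a , 2 + m , r))
successors-shiftᵐ zero          m zero    = refl
successors-shiftᵐ zero          m (suc r) = refl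
successors-shiftᵐ (suc zero)    m zero    = refl
successors-shiftᵐ (suc zero)    m (suc r) = refl
successors-shiftᵐ (suc (suc a)) m zero    = refl
successors-shiftᵐ (suc (suc a)) m (suc r) = refl

successors-shiftʳ : ∀ a m r → successors (a , m , 3 + r) ≡ map shiftʳ (successors (a , m , 1 + r))
successors-shiftʳ zero          zero          r = refl
successors-shiftʳ zero          (suc zero)    r = refl
successors-shiftʳ zero          (suc (suc m)) r = refl
successors-shiftʳ (suc zero)    zero          r = refl
successors-shiftʳ (suc zero)    (suc zero)    r = refl
successors-shiftʳ (suc zero)    (suc (suc m)) r = refl
successors-shiftʳ (suc (suc a)) zero          r = refl
successors-shiftʳ (suc (suc a)) (suc zero)    r = refl
successors-shiftʳ (suc (suc a)) (suc (suc m)) r = refl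

bellmanValue-invariant : ∀ p σ s {t} → successors (σ s) ≡ map σ (successors s) → t ∈ successors s →
  (∀ {u} → u ∈ successors s → finalDeficiency (other p) (σ u) ≡ finalDeficiency (other p) u) →
  bellmanValue p (σ s) ≡ bellmanValue p s
bellmanValue-invariant p σ s shift t∈ periodic = begin
  best q (deficiency (σ s)) (map f (successors (σ s)))    ≡⟨ cong (λ us → best q (deficiency (σ s)) (map f us)) shift ⟩
  best q (deficiency (σ s)) (map f (map σ (successors s))) ≡⟨ cong (best q _) (sym (map-∘ (successors s))) ⟩
  best q (deficiency (σ s)) (map (f ∘ σ) (successors s))   ≡⟨ cong (best q _) (map-cong-local (All.tabulate periodic)) ⟩
  best q (deficiency (σ s)) (map f (successors s))         ≡⟨ best-default q _ _ (∈-map⁺ f t∈) ⟩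
  best q (deficiency s) (map f (successors s))             ∎
  where
  open ≡-Reasoning
  q = other p
  f = finalDeficiency q

finalDeficiency-shiftᵃ : ∀ p a m r → 8 ≤ a → finalDeficiency p (2 + a , m , r) ≡ finalDeficiency p (a , m , r)
finalDeficiency-shiftᵃ p a m r 8≤a = cong (λ x → deficiencyTable p x (reduce 5 m) (reduce 4 r)) (reduce-periodic 8≤a)

finalDeficiency-shiftᵐ : ∀ p a m r → 5 ≤ m → finalDeficiency p (a , 2 + m , r) ≡ finalDeficiency p (a , m , r)
finalDeficiency-shiftᵐ p a m r 5≤m = cong (λ x → deficiencyTable p (reduce 8 a) x (reduce 4 r)) (reduce-periodic 5≤m)

finalDeficiency-shiftʳ : ∀ p a m r → 4 ≤ r → finalDeficiency p (a , m , 2 + r) ≡ finalDeficiency p (a , m , r)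
finalDeficiency-shiftʳ p a m r 4≤r = cong (λ x → deficiencyTable p (reduce 8 a) (reduce 5 m) x) (reduce-periodic 4≤r)

bellmanValue-shiftᵃ : ∀ p a m r → 8 ≤ a → bellmanValue p (4 + a , m , r) ≡ bellmanValue p (2 + a , m , r)
bellmanValue-shiftᵃ p a m r 8≤a =
  bellmanValue-invariant p shiftᵃ (2 + a , m , r) (successors-shiftᵃ a m r) (∈-successors⁺ (iso-iso {a} {m} {r})) periodic
  where
  periodic : ∀ {u} → u ∈ successors (2 + a , m , r) → finalDeficiency (other p) (shiftᵃ u) ≡ finalDeficiency (other p) u
  periodic {a′ , m′ , r′} u∈ with _ , st ← ∈-successors⁻ (2 + a , m , r) u∈ =
    finalDeficiency-shiftᵃ (other p) a′ m′ r′ (≤-trans 8≤a (+-cancelˡ-≤ 2 _ _ (proj₁ (⟶-drop st))))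

bellmanValue-shiftᵐ : ∀ p a m r → 5 ≤ m → bellmanValue p (a , 4 + m , r) ≡ bellmanValue p (a , 2 + m , r)
bellmanValue-shiftᵐ p a m r 5≤m =
  bellmanValue-invariant p shiftᵐ (a , 2 + m , r) (successors-shiftᵐ a m r) (∈-successors⁺ (k₂-k₂ {a} {m} {r})) periodic
  where
  periodic : ∀ {u} → u ∈ successors (a , 2 + m , r) → finalDeficiency (other p) (shiftᵐ u) ≡ finalDeficiency (other p) u
  periodic {a′ , m′ , r′} u∈ with _ , st ← ∈-successors⁻ (a , 2 + m , r) u∈ =
    finalDeficiency-shiftᵐ (other p) a′ m′ r′ (≤-trans 5≤m (+-cancelˡ-≤ 2 _ _ (proj₁ (proj₂ (⟶-drop st)))))

bellmanValue-shiftʳ : ∀ p a m r → 4 ≤ r → bellmanValue p (a , m , 3 + r) ≡ bellmanValue p (a , m , 1 + r)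
bellmanValue-shiftʳ p a m r 4≤r =
  bellmanValue-invariant p shiftʳ (a , m , 1 + r) (successors-shiftʳ a m r) (∈-successors⁺ (path-path {a} {m} {r})) periodic
  where
  periodic : ∀ {u} → u ∈ successors (a , m , 1 + r) → finalDeficiency (other p) (shiftʳ u) ≡ finalDeficiency (other p) u
  periodic {a′ , m′ , r′} u∈ with _ , st ← ∈-successors⁻ (a , m , 1 + r) u∈ =
    finalDeficiency-shiftʳ (other p) a′ m′ r′ (≤-trans 4≤r (+-cancelˡ-≤ 1 _ _ (proj₂ (proj₂ (⟶-drop st)))))

bellman : ∀ p s → Bellman p s
bellman p (a , m , r) = extend-periodic 10 12 ≤-refl below-12 nextᵃ a m r
  where
  below-12-9 : ∀ {a m} → a < 12 → m < 9 → ∀ r → Bellman p (a , m , r)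
  below-12-9 {a} {m} a<12 m<9 = extend-periodic 5 7 ≤-refl (λ r r<7 → bellman-box p a<12 m<9 r<7) nextʳ
    where
    nextʳ : ∀ r → 5 ≤ r → Bellman p (a , m , r) → Bellman p (a , m , 2 + r)
    nextʳ (suc r) (s≤s 4≤r) IH = trans (bellmanValue-shiftʳ p a m r 4≤r)
      (trans IH (sym (finalDeficiency-shiftʳ p a m (suc r) (≤-trans 4≤r (n≤1+n r)))))

  below-12 : ∀ a → a < 12 → ∀ m r → Bellman p (a , m , r)
  below-12 a a<12 = extend-periodic 7 9 ≤-refl (λ m m<9 → below-12-9 a<12 m<9) nextᵐ
    where
    nextᵐ : ∀ m → 7 ≤ m → (∀ r → Bellman p (a , m , r)) → ∀ r → Bellman p (a , 2 + m , r)
    nextᵐ (suc (suc m)) (s≤s (s≤s 5≤m)) IH r = trans (bellmanValue-shiftᵐ p a m r 5≤m)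
      (trans (IH r) (sym (finalDeficiency-shiftᵐ p a (2 + m) r (≤-trans 5≤m (m≤n+m m 2)))))

  nextᵃ : ∀ a → 10 ≤ a → (∀ m r → Bellman p (a , m , r)) → ∀ m r → Bellman p (2 + a , m , r)
  nextᵃ (suc (suc a)) (s≤s (s≤s 8≤a)) IH m r = trans (bellmanValue-shiftᵃ p a m r 8≤a)
    (trans (IH m r) (sym (finalDeficiency-shiftᵃ p (2 + a) m r (≤-trans 8≤a (m≤n+m a 2)))))

finalDeficiency-done : ∀ p → finalDeficiency p (0 , 0 , 0) ≡ 0
finalDeficiency-done Max  = refl
finalDeficiency-done Mini = refl

reduce-above : ∀ {t x} → t ≤ x → reduce t x ≡ t + (x ∸ t) % 2
reduce-above {t} {x} t≤x = cong (_+ (x ∸ t) % 2) (m≥n⇒m⊓n≡n t≤x)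

-- Graphs of maximum degree two

-- kindOf (degree of v) (degree of its neighbour): a vertex of degree 1 ends a single-edge
-- component exactly when its neighbour has degree 1 too.
kindOf : ℕ → ℕ → Maybe Kind
kindOf zero          _          = just isolated
kindOf (suc zero)    (suc zero) = just k₂-end
kindOf (suc zero)    _          = just path-end
kindOf (suc (suc _)) _          = nothing

kindDegree : Kind → ℕ
kindDegree isolated = 0
kindDegree k₂-end   = 1
kindDegree path-end = 1

kindOf-degree : ∀ d e {κ} → kindOf d e ≡ just κ → d ≡ kindDegree κ
kindOf-degree zero                e          refl = refl
kindOf-degree (suc zero)          (suc zero) refl = refl
kindOf-degree (suc zero)          zero       refl = refl
kindOf-degree (suc zero)  (suc (suc e))      refl = refl

kindOf-k₂-end : ∀ d e → kindOf d e ≡ just k₂-end → e ≡ 1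
kindOf-k₂-end (suc zero) (suc zero)    _  = refl
kindOf-k₂-end zero       _             ()
kindOf-k₂-end (suc zero) zero          ()
kindOf-k₂-end (suc zero) (suc (suc _)) ()

kindOf-path-end : ∀ d e → kindOf d e ≡ just path-end → e ≢ 1
kindOf-path-end (suc zero) zero          _ ()
kindOf-path-end (suc zero) (suc (suc _)) _ ()
kindOf-path-end zero       _             ()
kindOf-path-end (suc zero) (suc zero)    ()

kindOf-defined : ∀ d e → d ≤ 1 → ∃[ κ ] kindOf d e ≡ just κ
kindOf-defined zero       e             _ = isolated , refl
kindOf-defined (suc zero) (suc zero)    _ = k₂-end , refl
kindOf-defined (suc zero) zero          _ = path-end , refl
kindOf-defined (suc zero) (suc (suc e)) _ = path-end , refl
kindOf-defined (suc (suc _)) _ (s≤s ())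

joinedKind : Kind → Kind → Maybe Kind
joinedKind κ κ′ = kindOf (suc (kindDegree κ)) (suc (kindDegree κ′))

kindDegree≤1 : ∀ κ → kindDegree κ ≤ 1
kindDegree≤1 = all-kinds z≤n ≤-refl ≤-refl

module _ {n : ℕ} where

  opposite : Edge n → Fin n → Fin n
  opposite (a , b) v = if does (v ≟ a) then b else a

  neighbour : Graph n → Fin n → Fin n
  neighbour []      v = v
  neighbour (e ∷ G) v = if incident v e then opposite e v else neighbour G v

  Canonical : Graph n → Set
  Canonical = All (λ e → toℕ (proj₁ e) < toℕ (proj₂ e))

  record NonAdjacent (G : Graph n) (x y : Fin n) : Set where
    constructor nonAdjacent
    field
      separated : ∀ {f} → f ∈ G → incident x f ≡ true → incident y f ≡ false
  open NonAdjacent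

  incident-fst : ∀ (a b : Fin n) → incident a (a , b) ≡ true
  incident-fst a b rewrite dec-true (a ≟ a) refl = refl

  incident-snd : ∀ (a b : Fin n) → incident b (a , b) ≡ true
  incident-snd a b rewrite dec-true (b ≟ b) refl = ∨-zeroʳ (does (b ≟ a))

  incident-neither : ∀ {w a b : Fin n} → w ≢ a → w ≢ b → incident w (a , b) ≡ false
  incident-neither {w} {a} {b} w≢a w≢b rewrite dec-false (w ≟ a) w≢a | dec-false (w ≟ b) w≢b = refl

  incident-end : ∀ {w a b : Fin n} → incident w (a , b) ≡ true → w ≡ a ⊎ w ≡ b
  incident-end {w} {a} {b} inc with w ≟ a | w ≟ b
  ... | yes w≡a | _       = inj₁ w≡a
  ... | no _    | yes w≡b = inj₂ w≡b
  ... | no _    | no _    = contradiction inc λ ()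

  opposite-fst : ∀ (a b : Fin n) → opposite (a , b) a ≡ b
  opposite-fst a b rewrite dec-true (a ≟ a) refl = refl

  opposite-snd : ∀ {a b : Fin n} → a ≢ b → opposite (a , b) b ≡ a
  opposite-snd {a} {b} a≢b rewrite dec-false (b ≟ a) (a≢b ∘ sym) = refl

  opposite-incident : ∀ f (v : Fin n) → incident v f ≡ true → incident (opposite f v) f ≡ true
  opposite-incident (a , b) v inc with v ≟ a
  ... | yes _ = incident-snd a b
  ... | no _  = incident-fst a b

  opposite-≢ : ∀ f (v : Fin n) → proj₁ f ≢ proj₂ f → incident v f ≡ true → opposite f v ≢ v
  opposite-≢ (a , b) v a≢b inc with incident-end {v} {a} {b} inc
  ... | inj₁ refl = λ b≡a → a≢b (sym (trans (sym (opposite-fst a b)) b≡a))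
  ... | inj₂ refl = λ a≡b → a≢b (trans (sym (opposite-snd a≢b)) a≡b)

  opposite-involutive : ∀ f (v : Fin n) → proj₁ f ≢ proj₂ f → incident v f ≡ true → opposite f (opposite f v) ≡ v
  opposite-involutive (a , b) v a≢b inc with incident-end {v} {a} {b} inc
  ... | inj₁ refl rewrite opposite-fst a b = opposite-snd a≢b
  ... | inj₂ refl rewrite opposite-snd a≢b = opposite-fst a b

  opposite-unique : ∀ f (v w : Fin n) → incident v f ≡ true → incident w f ≡ true → v ≢ w → opposite f v ≡ w
  opposite-unique (a , b) v w inc-v inc-w v≢w with incident-end {v} {a} {b} inc-v | incident-end {w} {a} {b} inc-w
  ... | inj₁ refl | inj₁ refl = contradiction refl v≢w
  ... | inj₁ refl | inj₂ refl = opposite-fst a b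
  ... | inj₂ refl | inj₁ refl = opposite-snd (v≢w ∘ sym)
  ... | inj₂ refl | inj₂ refl = contradiction refl v≢w

  canonical-proper : ∀ {G : Graph n} {f} → Canonical G → f ∈ G → proj₁ f ≢ proj₂ f
  canonical-proper canonical f∈ ends≡ = <-irrefl (cong toℕ ends≡) (All.lookup canonical f∈)

  deg-∷-incident : ∀ (G : Graph n) e w → incident w e ≡ true → deg (e ∷ G) w ≡ suc (deg G w)
  deg-∷-incident G e w inc = cong length (filter-accept (T? ∘ incident w) {e} {G} (subst T (sym inc) _))

  deg-∷-apart : ∀ (G : Graph n) e w → incident w e ≡ false → deg (e ∷ G) w ≡ deg G w
  deg-∷-apart G e w apart = cong length (filter-reject (T? ∘ incident w) {e} {G} (subst (¬_ ∘ T) (sym apart) λ ()))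

  neighbour-∷-incident : ∀ (G : Graph n) e w → incident w e ≡ true → neighbour (e ∷ G) w ≡ opposite e w
  neighbour-∷-incident G e w inc = cong (λ b → if b then opposite e w else neighbour G w) inc

  neighbour-∷-apart : ∀ (G : Graph n) e w → incident w e ≡ false → neighbour (e ∷ G) w ≡ neighbour G w
  neighbour-∷-apart G e w apart = cong (λ b → if b then opposite e w else neighbour G w) apart

  deg-pos : ∀ {G : Graph n} {f} (v : Fin n) → f ∈ G → incident v f ≡ true → 1 ≤ deg G v
  deg-pos v f∈ inc = nonempty (∈-filter⁺ (T? ∘ incident v) f∈ (subst T (sym inc) _))
    where
    nonempty : ∀ {A : Set} {x : A} {xs} → x ∈ xs → 1 ≤ length xs
    nonempty {xs = _ ∷ _} _ = s≤s z≤n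

  neighbour-edge : ∀ (G : Graph n) v → 1 ≤ deg G v →
    ∃[ f ] f ∈ G × incident v f ≡ true × neighbour G v ≡ opposite f v
  neighbour-edge (e ∷ G) v pos with true-or-false (incident v e)
  ... | inj₁ inc = e , here refl , inc , neighbour-∷-incident G e v inc
  ... | inj₂ inc with f , f∈ , inc-f , eq ← neighbour-edge G v (subst (1 ≤_) (deg-∷-apart G e v inc) pos) =
    f , there f∈ , inc-f , trans (neighbour-∷-apart G e v inc) eq

  neighbour-sole : ∀ (G : Graph n) v {f} → deg G v ≡ 1 → f ∈ G → incident v f ≡ true → neighbour G v ≡ opposite f v
  neighbour-sole (e ∷ G) v d (here refl) inc = neighbour-∷-incident G e v inc
  neighbour-sole (e ∷ G) v d (there f∈) inc with true-or-false (incident v e)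
  ... | inj₁ inc-e = contradiction (deg-pos v f∈ inc) (subst (λ k → ¬ 1 ≤ k) (sym deg-G) λ ())
    where deg-G = suc-injective (trans (sym (deg-∷-incident G e v inc-e)) d)
  ... | inj₂ inc-e =
    trans (neighbour-∷-apart G e v inc-e) (neighbour-sole G v (trans (sym (deg-∷-apart G e v inc-e)) d) f∈ inc)

  neighbour-≢ : ∀ {G : Graph n} {v} → Canonical G → 1 ≤ deg G v → neighbour G v ≢ v
  neighbour-≢ {G} {v} canonical pos with f , f∈ , inc , eq ← neighbour-edge G v pos =
    subst (_≢ v) (sym eq) (opposite-≢ f v (canonical-proper canonical f∈) inc)

  neighbour-deg : ∀ (G : Graph n) v → 1 ≤ deg G v → 1 ≤ deg G (neighbour G v)
  neighbour-deg G v pos with f , f∈ , inc , eq ← neighbour-edge G v pos =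
    subst (λ u → 1 ≤ deg G u) (sym eq) (deg-pos (opposite f v) f∈ (opposite-incident f v inc))

  neighbour-mutual : ∀ {G : Graph n} {v} → Canonical G → deg G v ≡ 1 → deg G (neighbour G v) ≡ 1 →
    neighbour G (neighbour G v) ≡ v
  neighbour-mutual {G} {v} canonical d d′ with f , f∈ , inc , eq ← neighbour-edge G v (≤-reflexive (sym d)) = begin
    neighbour G (neighbour G v)  ≡⟨ cong (neighbour G) eq ⟩
    neighbour G (opposite f v)   ≡⟨ neighbour-sole G (opposite f v) (subst (λ u → deg G u ≡ 1) eq d′) f∈
                                      (opposite-incident f v inc) ⟩
    opposite f (opposite f v)    ≡⟨ opposite-involutive f v (canonical-proper canonical f∈) inc ⟩
    v                            ∎
    where open ≡-Reasoning

  neighbour-apart : ∀ {G : Graph n} {v w} → NonAdjacent G v w → 1 ≤ deg G v → neighbour G v ≢ w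
  neighbour-apart {G} {v} {w} apart pos nv≡w with f , f∈ , inc , eq ← neighbour-edge G v pos =
    contradiction (trans (sym inc-w) (separated apart f∈ inc)) λ ()
    where
    inc-w : incident w f ≡ true
    inc-w = subst (λ u → incident u f ≡ true) (trans (sym eq) nv≡w) (opposite-incident f v inc)

  nonAdjacent-sym : ∀ {G : Graph n} {x y} → NonAdjacent G x y → NonAdjacent G y x
  nonAdjacent-sym {G} {x} {y} apart = nonAdjacent separated′
    where
    separated′ : ∀ {f} → f ∈ G → incident y f ≡ true → incident x f ≡ false
    separated′ {f} f∈ inc-y with true-or-false (incident x f)
    ... | inj₁ inc-x = contradiction (trans (sym inc-y) (separated apart f∈ inc-x)) λ ()
    ... | inj₂ inc-x = inc-x

  nonAdjacent-isolated : ∀ {G : Graph n} {v w} → deg G v ≡ 0 → NonAdjacent G v w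
  nonAdjacent-isolated {v = v} d = nonAdjacent λ f∈ inc → contradiction (subst (1 ≤_) d (deg-pos v f∈ inc)) λ ()

  nonAdjacent-leaf : ∀ {G : Graph n} {v w} → deg G v ≡ 1 → v ≢ w → neighbour G v ≢ w → NonAdjacent G v w
  nonAdjacent-leaf {G} {v} {w} d v≢w nv≢w = nonAdjacent separated′
    where
    separated′ : ∀ {f} → f ∈ G → incident v f ≡ true → incident w f ≡ false
    separated′ {f} f∈ inc-v with true-or-false (incident w f)
    ... | inj₁ inc-w = contradiction (trans (neighbour-sole G v d f∈ inc-v) (opposite-unique f v w inc-v inc-w v≢w)) nv≢w
    ... | inj₂ inc-w = inc-w

  kind : Graph n → Fin n → Maybe Kind
  kind G v = kindOf (deg G v) (deg G (neighbour G v))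

  census : Graph n → Kind → ℕ
  census G κ = count (λ v → kind G v is κ)

  kind-deg : ∀ (G : Graph n) v {κ} → kind G v ≡ just κ → deg G v ≡ kindDegree κ
  kind-deg G v = kindOf-degree (deg G v) _

  kind-defined : ∀ (G : Graph n) v → deg G v ≤ 1 → ∃[ κ ] kind G v ≡ just κ
  kind-defined G v = kindOf-defined (deg G v) _

  k₂-end-partner : ∀ {G : Graph n} → Canonical G → ∀ v → kind G v ≡ just k₂-end →
    kind G (neighbour G v) ≡ just k₂-end × neighbour G (neighbour G v) ≡ v
  k₂-end-partner {G} canonical v k =
    subst (λ u → kindOf (deg G (neighbour G v)) (deg G u) ≡ just k₂-end) (sym back) k′ , back
    where
    d = kind-deg G v k
    d′ = kindOf-k₂-end (deg G v) _ k
    back = neighbour-mutual canonical d d′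
    k′ : kindOf (deg G (neighbour G v)) (deg G v) ≡ just k₂-end
    k′ = cong₂ kindOf d′ d

  pick : ∀ (G : Graph n) κ S → Unique S → length S < census G κ → ∃[ v ] kind G v ≡ just κ × v ∉ S
  pick G κ S unique S<census with v , is , v∉S ← count-avoid (λ v → kind G v is κ) S unique S<census = v , is-just is , v∉S

  p3Count-join : ∀ {G : Graph n} {x y} → NonAdjacent G x y → p3Count ((x , y) ∷ G) ≡ deg G x + deg G y + p3Count G
  p3Count-join {G} {x} {y} apart = cong (_+ p3Count G) (length-filter-∨ (incident x) (incident y) G (separated apart))

  record Effect (G G⁺ : Graph n) (μ : Move) : Set where
    field
      census-step   : ∀ κ → tally (consumed μ) κ + census G⁺ κ ≡ tally (produced μ) κ + census G κ
      census-enough : ∀ κ → tally (consumed μ) κ ≤ census G κ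
      p3Count-step  : p3Count G⁺ ≡ gain μ + p3Count G

  -- N is the number of vertices: p3Count G counts those of degree 2, deficiency s the others.
  record Represents (N : ℕ) (G : Graph n) (s : Shape) : Set where
    field
      census-shape : ∀ κ → census G κ ≡ shapeCensus s κ
      score        : p3Count G + deficiency s ≡ N

  represents-step : ∀ {N G G⁺ s μ} → Represents N G s → Effect G G⁺ μ → ∃[ t ] μ ⊢ s ⟶ t × Represents N G⁺ t
  represents-step {N} {G} {G⁺} {s} {μ} rep eff = next (⟶-enabled μ s enabled)
    where
    open Represents rep
    open Effect eff
    enabled : Enabled μ s
    enabled κ = subst (tally (consumed μ) κ ≤_) (census-shape κ) (census-enough κ)
    next : ∃[ t ] μ ⊢ s ⟶ t → ∃[ t ] μ ⊢ s ⟶ t × Represents N G⁺ t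
    next (t , st) = t , st , record
      { census-shape = λ κ → +-cancelˡ-≡ (tally (consumed μ) κ) _ _ (census-t κ)
      ; score        = score-t
      }
      where
      census-t : ∀ κ → tally (consumed μ) κ + census G⁺ κ ≡ tally (consumed μ) κ + shapeCensus t κ
      census-t κ = begin
        tally (consumed μ) κ + census G⁺ κ     ≡⟨ census-step κ ⟩
        tally (produced μ) κ + census G κ      ≡⟨ cong (tally (produced μ) κ +_) (census-shape κ) ⟩
        tally (produced μ) κ + shapeCensus s κ ≡⟨ ⟶-census st κ ⟨
        tally (consumed μ) κ + shapeCensus t κ ∎
        where open ≡-Reasoning
      score-t : p3Count G⁺ + deficiency t ≡ N
      score-t = begin
        p3Count G⁺ + deficiency t            ≡⟨ cong (_+ deficiency t) p3Count-step ⟩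
        gain μ + p3Count G + deficiency t    ≡⟨ xy∙z≈y∙xz (gain μ) (p3Count G) (deficiency t) ⟩
        p3Count G + (gain μ + deficiency t)  ≡⟨ cong (p3Count G +_) (⟶-deficiency st) ⟨
        p3Count G + deficiency s             ≡⟨ score ⟩
        N                                    ∎
        where open ≡-Reasoning

  effect-from : ∀ {G G⁺ : Graph n} μ S → Unique S → (∀ w → w ∉ S → kind G⁺ w ≡ kind G w) →
    map (kind G) S ≡ consumed μ → map (kind G⁺) S ≡ produced μ → p3Count G⁺ ≡ gain μ + p3Count G → Effect G G⁺ μ
  effect-from {G} {G⁺} μ S unique unaffected before after p3 = record
    { census-step   = balance
    ; census-enough = enough
    ; p3Count-step  = p3
    }
    where
    tally-S : ∀ H {ks} → map (kind H) S ≡ ks → ∀ κ → countOn (λ v → kind H v is κ) S ≡ tally ks κ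
    tally-S H refl κ = sym (countOn-map (_is κ) (kind H) S)
    balance : ∀ κ → tally (consumed μ) κ + census G⁺ κ ≡ tally (produced μ) κ + census G κ
    balance κ = begin
      tally (consumed μ) κ + census G⁺ κ  ≡⟨ +-comm (tally (consumed μ) κ) _ ⟩
      census G⁺ κ + tally (consumed μ) κ  ≡⟨ cong (census G⁺ κ +_) (tally-S G before κ) ⟨
      census G⁺ κ + countOn (λ v → kind G v is κ) S
        ≡⟨ count-differ-on _ _ S unique (λ w → cong (_is κ) ∘ unaffected w) ⟩
      census G κ + countOn (λ v → kind G⁺ v is κ) S  ≡⟨ cong (census G κ +_) (tally-S G⁺ after κ) ⟩
      census G κ + tally (produced μ) κ   ≡⟨ +-comm (census G κ) _ ⟩
      tally (produced μ) κ + census G κ   ∎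
      where open ≡-Reasoning
    enough : ∀ κ → tally (consumed μ) κ ≤ census G κ
    enough κ = subst (_≤ census G κ) (tally-S G before κ) (countOn-≤-count _ S unique)

  module AddEdge {G : Graph n} (canonical : Canonical G) {x y : Fin n} (x≢y : x ≢ y) (apart : NonAdjacent G x y)
              (x-free : deg G x ≤ 1) (y-free : deg G y ≤ 1) where

    G⁺ : Graph n
    G⁺ = (x , y) ∷ G

    -- Ends u v says {u , v} = {x , y}; it lets each kind of move be treated once for both
    -- orientations of the new edge.
    data Ends : Fin n → Fin n → Set where
      xy : Ends x y
      yx : Ends y x

    flip : ∀ {u v} → Ends u v → Ends v u
    flip xy = yx
    flip yx = xy

    ends-≢ : ∀ {u v} → Ends u v → u ≢ v
    ends-≢ xy = x≢y
    ends-≢ yx = x≢y ∘ sym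

    ends-apart : ∀ {u v} → Ends u v → NonAdjacent G u v
    ends-apart xy = apart
    ends-apart yx = nonAdjacent-sym apart

    ends-free : ∀ {u v} → Ends u v → deg G u ≤ 1
    ends-free xy = x-free
    ends-free yx = y-free

    ends-incident : ∀ {u v} → Ends u v → incident u (x , y) ≡ true
    ends-incident xy = incident-fst x y
    ends-incident yx = incident-snd x y

    deg⁺-end : ∀ {u v} → Ends u v → deg G⁺ u ≡ suc (deg G u)
    deg⁺-end {u} e = deg-∷-incident G (x , y) u (ends-incident e)

    neighbour⁺-end : ∀ {u v} → Ends u v → neighbour G⁺ u ≡ v
    neighbour⁺-end xy = trans (neighbour-∷-incident G (x , y) x (incident-fst x y)) (opposite-fst x y)
    neighbour⁺-end yx = trans (neighbour-∷-incident G (x , y) y (incident-snd x y)) (opposite-snd x≢y)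

    deg⁺-off : ∀ {w} → w ≢ x → w ≢ y → deg G⁺ w ≡ deg G w
    deg⁺-off {w} w≢x w≢y = deg-∷-apart G (x , y) w (incident-neither w≢x w≢y)

    neighbour⁺-off : ∀ {w} → w ≢ x → w ≢ y → neighbour G⁺ w ≡ neighbour G w
    neighbour⁺-off {w} w≢x w≢y = neighbour-∷-apart G (x , y) w (incident-neither w≢x w≢y)

    off-ends : ∀ {u v w} → Ends u v → w ≢ u → w ≢ v → w ≢ x × w ≢ y
    off-ends xy w≢u w≢v = w≢u , w≢v
    off-ends yx w≢u w≢v = w≢v , w≢u

    kind⁺-end : ∀ {u v κ κ′} → Ends u v → kind G u ≡ just κ → kind G v ≡ just κ′ →
      kind G⁺ u ≡ joinedKind κ κ′
    kind⁺-end {u} {v} {κ} {κ′} e ku kv = begin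
      kindOf (deg G⁺ u) (deg G⁺ (neighbour G⁺ u))       ≡⟨ cong (kindOf _ ∘ deg G⁺) (neighbour⁺-end e) ⟩
      kindOf (deg G⁺ u) (deg G⁺ v)                      ≡⟨ cong₂ kindOf (deg⁺-end e) (deg⁺-end (flip e)) ⟩
      kindOf (suc (deg G u)) (suc (deg G v))            ≡⟨ cong₂ (λ d d′ → kindOf (suc d) (suc d′)) (kind-deg G u ku)
                                                                                                  (kind-deg G v kv) ⟩
      kindOf (suc (kindDegree κ)) (suc (kindDegree κ′)) ∎
      where open ≡-Reasoning

    partner-≢ : ∀ {u v} → Ends u v → kind G u ≡ just k₂-end → neighbour G u ≢ u × neighbour G u ≢ v
    partner-≢ {u} e ku = neighbour-≢ canonical leaf , neighbour-apart (ends-apart e) leaf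
      where leaf = ≤-reflexive (sym (kind-deg G u ku))

    kind⁺-partner : ∀ {u v} → Ends u v → kind G u ≡ just k₂-end → kind G⁺ (neighbour G u) ≡ just path-end
    kind⁺-partner {u} {v} e ku = begin
      kindOf (deg G⁺ z) (deg G⁺ (neighbour G⁺ z)) ≡⟨ cong₂ (λ d w → kindOf d (deg G⁺ w)) (deg⁺-off z≢x z≢y)
                                                                                         (neighbour⁺-off z≢x z≢y) ⟩
      kindOf (deg G z) (deg G⁺ (neighbour G z))   ≡⟨ cong₂ (λ d w → kindOf d (deg G⁺ w)) (kind-deg G z kz) back ⟩
      kindOf 1 (deg G⁺ u)                         ≡⟨ cong (kindOf 1) (trans (deg⁺-end e) (cong suc (kind-deg G u ku))) ⟩
      just path-end                               ∎
      where
      open ≡-Reasoning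
      z = neighbour G u
      kz = proj₁ (k₂-end-partner canonical u ku)
      back = proj₂ (k₂-end-partner canonical u ku)
      z≢x = proj₁ (off-ends e (proj₁ (partner-≢ e ku)) (proj₂ (partner-≢ e ku)))
      z≢y = proj₂ (off-ends e (proj₁ (partner-≢ e ku)) (proj₂ (partner-≢ e ku)))

    kind⁺-off : ∀ {w} → w ≢ x → w ≢ y → (deg G w ≡ 1 → neighbour G w ≢ x × neighbour G w ≢ y) →
      kind G⁺ w ≡ kind G w
    kind⁺-off {w} w≢x w≢y leaf-apart rewrite deg⁺-off w≢x w≢y | neighbour⁺-off w≢x w≢y with deg G w
    ... | zero        = refl
    ... | suc (suc _) = refl
    ... | suc zero with nx , ny ← leaf-apart refl rewrite deg⁺-off nx ny = refl

    neighbour-at-end : ∀ {u v w} → Ends u v → deg G w ≡ 1 → neighbour G w ≡ u →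
      kind G u ≡ just k₂-end × neighbour G u ≡ w
    neighbour-at-end {u} {v} {w} e d nw≡u = k₂ , back
      where
      du : deg G u ≡ 1
      du = ≤-antisym (ends-free e) (subst (λ z → 1 ≤ deg G z) nw≡u (neighbour-deg G w (≤-reflexive (sym d))))
      back : neighbour G u ≡ w
      back = subst (λ z → neighbour G z ≡ w) nw≡u
               (neighbour-mutual canonical d (subst (λ z → deg G z ≡ 1) (sym nw≡u) du))
      k₂ : kind G u ≡ just k₂-end
      k₂ rewrite du | back | d = refl

    unaffected-xy : ∀ S → x ∈ S → y ∈ S → (kind G x ≡ just k₂-end → neighbour G x ∈ S) →
      (kind G y ≡ just k₂-end → neighbour G y ∈ S) → ∀ w → w ∉ S → kind G⁺ w ≡ kind G w
    unaffected-xy S x∈ y∈ partner-x partner-y w w∉ =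
      kind⁺-off (λ { refl → w∉ x∈ }) (λ { refl → w∉ y∈ }) λ d → not-x d , not-y d
      where
      not-x : deg G w ≡ 1 → neighbour G w ≢ x
      not-x d nw≡x with k₂ , back ← neighbour-at-end xy d nw≡x = w∉ (subst (_∈ S) back (partner-x k₂))
      not-y : deg G w ≡ 1 → neighbour G w ≢ y
      not-y d nw≡y with k₂ , back ← neighbour-at-end yx d nw≡y = w∉ (subst (_∈ S) back (partner-y k₂))

    unaffected : ∀ {u v} → Ends u v → ∀ S → u ∈ S → v ∈ S → (kind G u ≡ just k₂-end → neighbour G u ∈ S) →
      (kind G v ≡ just k₂-end → neighbour G v ∈ S) → ∀ w → w ∉ S → kind G⁺ w ≡ kind G w
    unaffected xy S u∈ v∈ partner-u partner-v = unaffected-xy S u∈ v∈ partner-u partner-v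
    unaffected yx S u∈ v∈ partner-u partner-v = unaffected-xy S v∈ u∈ partner-v partner-u

    p3Count⁺ : ∀ {u v κ κ′} → Ends u v → kind G u ≡ just κ → kind G v ≡ just κ′ →
      p3Count G⁺ ≡ kindDegree κ + kindDegree κ′ + p3Count G
    p3Count⁺ xy ku kv = trans (p3Count-join apart) (cong₂ (λ d d′ → d + d′ + p3Count G) (kind-deg G x ku) (kind-deg G y kv))
    p3Count⁺ yx ku kv = trans (p3Count-join apart)
      (cong (_+ p3Count G) (trans (+-comm (deg G x) (deg G y)) (cong₂ _+_ (kind-deg G y ku) (kind-deg G x kv))))

    no-partner : ∀ {w κ} {A : Set} → kind G w ≡ just κ → κ ≢ k₂-end → kind G w ≡ just k₂-end → A
    no-partner kw κ≢k₂ k₂ = contradiction (just-injective (trans (sym kw) k₂)) κ≢k₂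

    effect-without-partners : ∀ {u v κ κ′} μ → Ends u v → kind G u ≡ just κ → kind G v ≡ just κ′ →
      κ ≢ k₂-end → κ′ ≢ k₂-end → just κ ∷ just κ′ ∷ [] ≡ consumed μ →
      joinedKind κ κ′ ∷ joinedKind κ′ κ ∷ [] ≡ produced μ → kindDegree κ + kindDegree κ′ ≡ gain μ →
      Effect G G⁺ μ
    effect-without-partners {u} {v} μ e ku kv κ≢k₂ κ′≢k₂ before after degrees =
      effect-from μ (u ∷ v ∷ []) ((ends-≢ e ∷ []) ∷ [] ∷ [])
        (unaffected e _ (here refl) (there (here refl)) (no-partner ku κ≢k₂) (no-partner kv κ′≢k₂))
        (trans (cong₂ _∷_ ku (cong (_∷ []) kv)) before)
        (trans (cong₂ _∷_ (kind⁺-end e ku kv) (cong (_∷ []) (kind⁺-end (flip e) kv ku))) after)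
        (trans (p3Count⁺ e ku kv) (cong (_+ p3Count G) degrees))

    effect-iso-k₂ : ∀ {u v} → Ends u v → kind G u ≡ just isolated → kind G v ≡ just k₂-end → Effect G G⁺ iso-k₂
    effect-iso-k₂ {u} {v} e ku kv = effect-from iso-k₂ (u ∷ v ∷ z ∷ []) unique
      (unaffected e _ (here refl) (there (here refl)) (no-partner ku λ ()) (λ _ → there (there (here refl))))
      (cong₂ _∷_ ku (cong₂ _∷_ kv (cong (_∷ []) (proj₁ (k₂-end-partner canonical v kv)))))
      (cong₂ _∷_ (kind⁺-end e ku kv) (cong₂ _∷_ (kind⁺-end (flip e) kv ku) (cong (_∷ []) (kind⁺-partner (flip e) kv))))
      (p3Count⁺ e ku kv)
      where
      z = neighbour G v
      z≢v = proj₁ (partner-≢ (flip e) kv)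
      z≢u = proj₂ (partner-≢ (flip e) kv)
      unique : Unique (u ∷ v ∷ z ∷ [])
      unique = (ends-≢ e ∷ (z≢u ∘ sym) ∷ []) ∷ ((z≢v ∘ sym) ∷ []) ∷ [] ∷ []

    effect-k₂-k₂ : ∀ {u v} → Ends u v → kind G u ≡ just k₂-end → kind G v ≡ just k₂-end → Effect G G⁺ k₂-k₂
    effect-k₂-k₂ {u} {v} e ku kv = effect-from k₂-k₂ (u ∷ v ∷ zu ∷ zv ∷ []) unique
      (unaffected e _ (here refl) (there (here refl)) (λ _ → there (there (here refl)))
                                                      (λ _ → there (there (there (here refl)))))
      (cong₂ _∷_ ku (cong₂ _∷_ kv (cong₂ _∷_ (proj₁ (k₂-end-partner canonical u ku))
                                             (cong (_∷ []) (proj₁ (k₂-end-partner canonical v kv))))))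
      (cong₂ _∷_ (kind⁺-end e ku kv) (cong₂ _∷_ (kind⁺-end (flip e) kv ku)
        (cong₂ _∷_ (kind⁺-partner e ku) (cong (_∷ []) (kind⁺-partner (flip e) kv)))))
      (p3Count⁺ e ku kv)
      where
      zu = neighbour G u
      zv = neighbour G v
      zu≢u = proj₁ (partner-≢ e ku)
      zu≢v = proj₂ (partner-≢ e ku)
      zv≢v = proj₁ (partner-≢ (flip e) kv)
      zv≢u = proj₂ (partner-≢ (flip e) kv)
      zu≢zv : zu ≢ zv
      zu≢zv zu≡zv = ends-≢ e (trans (sym (proj₂ (k₂-end-partner canonical u ku)))
                               (trans (cong (neighbour G) zu≡zv) (proj₂ (k₂-end-partner canonical v kv))))
      unique : Unique (u ∷ v ∷ zu ∷ zv ∷ [])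
      unique = (ends-≢ e ∷ (zu≢u ∘ sym) ∷ (zv≢u ∘ sym) ∷ []) ∷ ((zu≢v ∘ sym) ∷ (zv≢v ∘ sym) ∷ [])
             ∷ (zu≢zv ∷ []) ∷ [] ∷ []

    effect-k₂-path : ∀ {u v} → Ends u v → kind G u ≡ just k₂-end → kind G v ≡ just path-end → Effect G G⁺ k₂-path
    effect-k₂-path {u} {v} e ku kv = effect-from k₂-path (u ∷ v ∷ z ∷ []) unique
      (unaffected e _ (here refl) (there (here refl)) (λ _ → there (there (here refl))) (no-partner kv λ ()))
      (cong₂ _∷_ ku (cong₂ _∷_ kv (cong (_∷ []) (proj₁ (k₂-end-partner canonical u ku)))))
      (cong₂ _∷_ (kind⁺-end e ku kv) (cong₂ _∷_ (kind⁺-end (flip e) kv ku) (cong (_∷ []) (kind⁺-partner e ku))))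
      (p3Count⁺ e ku kv)
      where
      z = neighbour G u
      z≢u = proj₁ (partner-≢ e ku)
      z≢v = proj₂ (partner-≢ e ku)
      unique : Unique (u ∷ v ∷ z ∷ [])
      unique = (ends-≢ e ∷ (z≢u ∘ sym) ∷ []) ∷ ((z≢v ∘ sym) ∷ []) ∷ [] ∷ []

    effect : ∀ {u v κ κ′} → Ends u v → kind G u ≡ just κ → kind G v ≡ just κ′ → Effect G G⁺ (moveOf κ κ′)
    effect {κ = isolated} {isolated} e ku kv = effect-without-partners iso-iso e ku kv (λ ()) (λ ()) refl refl refl
    effect {κ = isolated} {k₂-end}   e ku kv = effect-iso-k₂ e ku kv
    effect {κ = isolated} {path-end} e ku kv = effect-without-partners iso-path e ku kv (λ ()) (λ ()) refl refl refl
    effect {κ = k₂-end}   {isolated} e ku kv = effect-iso-k₂ (flip e) kv ku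
    effect {κ = k₂-end}   {k₂-end}   e ku kv = effect-k₂-k₂ e ku kv
    effect {κ = k₂-end}   {path-end} e ku kv = effect-k₂-path e ku kv
    effect {κ = path-end} {isolated} e ku kv = effect-without-partners iso-path (flip e) kv ku (λ ()) (λ ()) refl refl refl
    effect {κ = path-end} {k₂-end}   e ku kv = effect-k₂-path (flip e) kv ku
    effect {κ = path-end} {path-end} e ku kv = effect-without-partners path-path e ku kv (λ ()) (λ ()) refl refl refl

  ==ᵉ-sound : ∀ (e g : Edge n) → (e ==ᵉ g) ≡ true → e ≡ g
  ==ᵉ-sound (a , b) (c , d) eq with a ≟ c | b ≟ d
  ... | yes refl | yes refl = refl
  ... | yes _    | no _     = contradiction eq λ ()
  ... | no _     | _        = contradiction eq λ ()

  ==ᵉ-refl : ∀ (e : Edge n) → (e ==ᵉ e) ≡ true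
  ==ᵉ-refl (a , b) rewrite dec-true (a ≟ a) refl | dec-true (b ≟ b) refl = refl

  ∈ᵍ⇒∈ : ∀ {e : Edge n} G → (e ∈ᵍ G) ≡ true → e ∈ G
  ∈ᵍ⇒∈ {e} (g ∷ G) eq with e ==ᵉ g in e≡g
  ... | true  = here (==ᵉ-sound e g e≡g)
  ... | false = there (∈ᵍ⇒∈ G eq)

  edgesFrom : Fin n → List (Edge n)
  edgesFrom u = map (u ,_) (filterᵇ (λ v → toℕ u <ᵇ toℕ v) (allFin n))

  ∈-allEdges⁺ : ∀ {u v : Fin n} → toℕ u < toℕ v → (u , v) ∈ allEdges n
  ∈-allEdges⁺ {u} {v} u<v =
    ∈-concatMap⁺ edgesFrom (lose (∈-allFin u) (∈-map⁺ (u ,_) (∈-filter⁺ (T? ∘ (toℕ u <ᵇ_) ∘ toℕ) (∈-allFin v)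
                                                                         (<⇒<ᵇ u<v))))

  ∈-allEdges⁻ : ∀ {u v : Fin n} → (u , v) ∈ allEdges n → toℕ u < toℕ v
  ∈-allEdges⁻ {u} {v} uv∈ with find (∈-concatMap⁻ edgesFrom {xs = allFin n} uv∈)
  ... | w , _ , uv∈w with ∈-map⁻ (w ,_) uv∈w
  ... | v′ , v′∈ , refl =
    <ᵇ⇒< (toℕ u) (toℕ v) (proj₂ (∈-filter⁻ (T? ∘ (toℕ u <ᵇ_) ∘ toℕ) {xs = allFin n} v′∈))

  ∈⇒∈ᵍ : ∀ {e : Edge n} {G} → e ∈ G → (e ∈ᵍ G) ≡ true
  ∈⇒∈ᵍ {e} {g ∷ G} (here refl) = cong (_∨ (e ∈ᵍ G)) (==ᵉ-refl e)
  ∈⇒∈ᵍ {e} {g ∷ G} (there e∈) = trans (cong ((e ==ᵉ g) ∨_) (∈⇒∈ᵍ e∈)) (∨-zeroʳ (e ==ᵉ g))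

  legalMoves⁺ : ∀ {G : Graph n} {x y} → toℕ x < toℕ y → NonAdjacent G x y → deg G x ≤ 1 → deg G y ≤ 1 →
    (x , y) ∈ legalMoves G
  legalMoves⁺ {G} {x} {y} x<y apart x-free y-free = ∈-filter⁺ (T? ∘ legal G) (∈-allEdges⁺ x<y) conditions
    where
    fresh : T (not ((x , y) ∈ᵍ G))
    fresh with true-or-false ((x , y) ∈ᵍ G)
    ... | inj₁ present =
      contradiction (trans (sym (incident-snd x y)) (separated apart (∈ᵍ⇒∈ G present) (incident-fst x y))) λ ()
    ... | inj₂ absent  = subst (T ∘ not) (sym absent) _
    conditions : T (legal G (x , y))
    conditions = Equivalence.from (T-∧ {not ((x , y) ∈ᵍ G)})
      (fresh , Equivalence.from (T-∧ {deg G x <ᵇ 2}) (<⇒<ᵇ (s≤s x-free) , <⇒<ᵇ (s≤s y-free)))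

  legalMoves⁻ : ∀ {G : Graph n} {x y} → Canonical G → (x , y) ∈ legalMoves G →
    toℕ x < toℕ y × NonAdjacent G x y × deg G x ≤ 1 × deg G y ≤ 1
  legalMoves⁻ {G} {x} {y} canonical xy∈ =
    x<y , nonAdjacent separated′ , ≤-pred (<ᵇ⇒< _ 2 (proj₁ free)) , ≤-pred (<ᵇ⇒< _ 2 (proj₂ free))
    where
    membership = ∈-filter⁻ (T? ∘ legal G) {xs = allEdges n} xy∈
    x<y : toℕ x < toℕ y
    x<y = ∈-allEdges⁻ (proj₁ membership)
    fresh : T (not ((x , y) ∈ᵍ G))
    fresh = proj₁ (Equivalence.to (T-∧ {not ((x , y) ∈ᵍ G)}) (proj₂ membership))
    free : T (deg G x <ᵇ 2) × T (deg G y <ᵇ 2)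
    free = Equivalence.to (T-∧ {deg G x <ᵇ 2}) (proj₂ (Equivalence.to (T-∧ {not ((x , y) ∈ᵍ G)}) (proj₂ membership)))
    separated′ : ∀ {f} → f ∈ G → incident x f ≡ true → incident y f ≡ false
    separated′ {a , b} f∈ inc-x with true-or-false (incident y (a , b))
    ... | inj₂ apart-y = apart-y
    ... | inj₁ inc-y with incident-end {x} {a} {b} inc-x | incident-end {y} {a} {b} inc-y
    ... | inj₁ refl | inj₁ refl = contradiction x<y (<-irrefl refl)
    ... | inj₂ refl | inj₂ refl = contradiction x<y (<-irrefl refl)
    ... | inj₁ refl | inj₂ refl = ⊥-elim (subst (T ∘ not) (∈⇒∈ᵍ f∈) fresh)
    ... | inj₂ refl | inj₁ refl = contradiction (All.lookup canonical f∈) (<-asym x<y)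

  kind-free : ∀ (G : Graph n) v {κ} → kind G v ≡ just κ → deg G v ≤ 1
  kind-free G v {κ} kv = subst (_≤ 1) (sym (kind-deg G v kv)) (kindDegree≤1 κ)

  kind-≢ : ∀ {G : Graph n} {u v κ κ′} → kind G u ≡ just κ → kind G v ≡ just κ′ → κ ≢ κ′ → u ≢ v
  kind-≢ {G} ku kv κ≢κ′ refl = κ≢κ′ (just-injective (trans (sym ku) kv))

  join-step : ∀ {N} {G : Graph n} {s x y κ κ′} → Canonical G → Represents N G s → x ≢ y → NonAdjacent G x y →
    kind G x ≡ just κ → kind G y ≡ just κ′ → ∃[ t ] moveOf κ κ′ ⊢ s ⟶ t × Represents N ((x , y) ∷ G) t
  join-step {G = G} {x = x} {y} canonical rep x≢y apart kx ky = represents-step rep (effect xy kx ky)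
    where open AddEdge canonical x≢y apart (kind-free G x kx) (kind-free G y ky)

  -- The saturation game follows the counter game

  legalMove⇒successor : ∀ {N} {G : Graph n} {s f} → Canonical G → Represents N G s → f ∈ legalMoves G →
    Canonical (f ∷ G) × ∃[ t ] t ∈ successors s × Represents N (f ∷ G) t
  legalMove⇒successor {G = G} {f = x , y} canonical rep f∈ =
    let x<y , apart , x-free , y-free = legalMoves⁻ canonical f∈
        _ , kx = kind-defined G x x-free
        _ , ky = kind-defined G y y-free
        t , st , rep′ = join-step canonical rep (<⇒≢ x<y ∘ cong toℕ) apart kx ky
    in x<y ∷ canonical , t , ∈-successors⁺ st , rep′

  join-legal : ∀ {N} {G : Graph n} {s t x y κ κ′} → Canonical G → Represents N G s → toℕ x < toℕ y →
    NonAdjacent G x y → kind G x ≡ just κ → kind G y ≡ just κ′ → moveOf κ κ′ ⊢ s ⟶ t →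
    ∃[ f ] f ∈ legalMoves G × Canonical (f ∷ G) × Represents N (f ∷ G) t
  join-legal {N} {G} {x = x} {y} canonical rep x<y apart kx ky st =
    let t′ , st′ , rep′ = join-step canonical rep (<⇒≢ x<y ∘ cong toℕ) apart kx ky
    in (x , y) , legalMoves⁺ x<y apart (kind-free G x kx) (kind-free G y ky) , x<y ∷ canonical ,
       subst (Represents N _) (sym (⟶-deterministic st st′)) rep′

  realise : ∀ {N} {G : Graph n} {s t u v κ κ′} → Canonical G → Represents N G s → u ≢ v → NonAdjacent G u v →
    kind G u ≡ just κ → kind G v ≡ just κ′ → moveOf κ κ′ ⊢ s ⟶ t →
    ∃[ f ] f ∈ legalMoves G × Canonical (f ∷ G) × Represents N (f ∷ G) t
  realise {s = s} {t} {u} {v} {κ} {κ′} canonical rep u≢v apart ku kv st with <-cmp (toℕ u) (toℕ v)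
  ... | tri< u<v _ _ = join-legal canonical rep u<v apart ku kv st
  ... | tri≈ _ u≡v _ = contradiction (toℕ-injective u≡v) u≢v
  ... | tri> _ _ v<u = join-legal canonical rep v<u (nonAdjacent-sym apart) kv ku (subst (_⊢ s ⟶ t) (moveOf-comm κ κ′) st)

  pick-represented : ∀ {N} {G : Graph n} {s} → Represents N G s → ∀ κ S → Unique S → length S < shapeCensus s κ →
    ∃[ v ] kind G v ≡ just κ × v ∉ S
  pick-represented {G = G} rep κ S unique S< = pick G κ S unique (subst (length S <_) (sym (Represents.census-shape rep κ)) S<)

  successor⇒legalMove : ∀ {N} {G : Graph n} {s μ t} → Canonical G → Represents N G s → μ ⊢ s ⟶ t →
    ∃[ f ] f ∈ legalMoves G × Canonical (f ∷ G) × Represents N (f ∷ G) t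
  successor⇒legalMove {G = G} canonical rep iso-iso =
    let u , ku , _  = pick-represented rep isolated [] [] (s≤s z≤n)
        v , kv , v∉ = pick-represented rep isolated (u ∷ []) ([] ∷ []) (s≤s (s≤s z≤n))
    in realise canonical rep (λ u≡v → v∉ (here (sym u≡v))) (nonAdjacent-isolated (kind-deg G u ku)) ku kv iso-iso
  successor⇒legalMove {G = G} canonical rep iso-k₂ =
    let u , ku , _ = pick-represented rep isolated [] [] (s≤s z≤n)
        v , kv , _ = pick-represented rep k₂-end [] [] (s≤s z≤n)
    in realise canonical rep (kind-≢ {G} ku kv λ ()) (nonAdjacent-isolated (kind-deg G u ku)) ku kv iso-k₂
  successor⇒legalMove {G = G} canonical rep iso-path =
    let u , ku , _ = pick-represented rep isolated [] [] (s≤s z≤n)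
        v , kv , _ = pick-represented rep path-end [] [] (s≤s z≤n)
    in realise canonical rep (kind-≢ {G} ku kv λ ()) (nonAdjacent-isolated (kind-deg G u ku)) ku kv iso-path
  successor⇒legalMove {G = G} canonical rep k₂-k₂ =
    let u , ku , _  = pick-represented rep k₂-end [] [] (s≤s z≤n)
        u≢partner   = neighbour-≢ canonical (≤-reflexive (sym (kind-deg G u ku))) ∘ sym
        v , kv , v∉ = pick-represented rep k₂-end (u ∷ neighbour G u ∷ []) ((u≢partner ∷ []) ∷ [] ∷ [])
                        (s≤s (s≤s (s≤s z≤n)))
        u≢v         = λ u≡v → v∉ (here (sym u≡v))
        partner≢v   = λ eq → v∉ (there (here (sym eq)))
    in realise canonical rep u≢v (nonAdjacent-leaf (kind-deg G u ku) u≢v partner≢v) ku kv k₂-k₂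
  successor⇒legalMove {G = G} canonical rep k₂-path =
    let u , ku , _ = pick-represented rep k₂-end [] [] (s≤s z≤n)
        v , kv , _ = pick-represented rep path-end [] [] (s≤s z≤n)
        u≢v        = kind-≢ {G} ku kv λ ()
        partner≢v  = kind-≢ {G} (proj₁ (k₂-end-partner canonical u ku)) kv λ ()
    in realise canonical rep u≢v (nonAdjacent-leaf (kind-deg G u ku) u≢v partner≢v) ku kv k₂-path
  successor⇒legalMove {G = G} canonical rep path-path =
    let u , ku , _  = pick-represented rep path-end [] [] (s≤s z≤n)
        v , kv , v∉ = pick-represented rep path-end (u ∷ []) ([] ∷ []) (s≤s (s≤s z≤n))
        u≢v         = λ u≡v → v∉ (here (sym u≡v))
        partner≢v   = λ eq → kindOf-path-end (deg G u) _ ku (trans (cong (deg G) eq) (kind-deg G v kv))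
    in realise canonical rep u≢v (nonAdjacent-leaf (kind-deg G u ku) u≢v partner≢v) ku kv path-path

  ∈-successors-size : ∀ s {t} → t ∈ successors s → suc (size t) ≡ size s
  ∈-successors-size s t∈ = ⟶-size (proj₂ (∈-successors⁻ s t∈))

  value-closed : ∀ k p {G : Graph n} {N s} → Canonical G → Represents N G s → size s ≤ k →
    value k p G ≡ N ∸ finalDeficiency p s
  value-closed zero p {G} {N} {zero , zero , zero} _ rep _ =
    trans (sym (+-identityʳ (p3Count G))) (trans (Represents.score rep) (cong (N ∸_) (sym (finalDeficiency-done p))))
  value-closed (suc k) p {G} {N} {s} canonical rep size≤ = begin
    value (suc k) p G                                       ≡⟨ value-suc k p G ⟩
    best p (p3Count G) (map continuation (legalMoves G))    ≡⟨ best-cong p score′ forward backward ⟩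
    best p (N ∸ deficiency s) (map payoff (successors s))   ≡⟨ cong (best p _) (map-∘ (successors s)) ⟩
    best p (N ∸ deficiency s) (map (N ∸_) deficiencies)     ≡⟨ ∸-best p N (deficiency s) deficiencies ⟨
    N ∸ bellmanValue p s                                    ≡⟨ cong (N ∸_) (bellman p s) ⟩
    N ∸ finalDeficiency p s                                 ∎
    where
    open ≡-Reasoning
    q = other p
    continuation : Edge n → ℕ
    continuation f = value k q (f ∷ G)
    payoff : Shape → ℕ
    payoff t = N ∸ finalDeficiency q t
    deficiencies = map (finalDeficiency q) (successors s)
    score′ : p3Count G ≡ N ∸ deficiency s
    score′ = trans (sym (m+n∸n≡m (p3Count G) (deficiency s))) (cong (_∸ deficiency s) (Represents.score rep))
    smaller : ∀ {t} → t ∈ successors s → size t ≤ k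
    smaller t∈ = s≤s⁻¹ (subst (_≤ suc k) (sym (∈-successors-size s t∈)) size≤)
    forward : map continuation (legalMoves G) ⊆ map payoff (successors s)
    forward x∈ =
      let f , f∈ , x≡ = ∈-map⁻ continuation x∈
          canonical′ , t , t∈ , rep′ = legalMove⇒successor canonical rep f∈
      in subst (_∈ _) (sym (trans x≡ (value-closed k q canonical′ rep′ (smaller t∈)))) (∈-map⁺ payoff t∈)
    backward : map payoff (successors s) ⊆ map continuation (legalMoves G)
    backward y∈ =
      let t , t∈ , y≡ = ∈-map⁻ payoff y∈
          f , f∈ , canonical′ , rep′ = successor⇒legalMove canonical rep (proj₂ (∈-successors⁻ s t∈))
      in subst (_∈ _) (trans (value-closed k q canonical′ rep′ (smaller t∈)) (sym y≡)) (∈-map⁺ continuation f∈)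

empty-represents : ∀ n → Represents {n} n [] (n , 0 , 0)
empty-represents n = record
  { census-shape = all-kinds (count-true n) (count-false n) (count-false n)
  ; score        = trans (+-identityʳ (n + 0)) (+-identityʳ n)
  }

≤-C₂ : ∀ {n} → 3 ≤ n → n ≤ n C 2
≤-C₂ {1} (s≤s ())
≤-C₂ {2} (s≤s (s≤s ()))
≤-C₂ {3} _ = ≤-refl
≤-C₂ {suc (suc (suc (suc n)))} _ = begin
  suc (3 + n)              ≤⟨ s≤s (≤-C₂ {suc (suc (suc n))} (s≤s (s≤s (s≤s z≤n)))) ⟩
  1 + (3 + n) C 2          ≤⟨ +-monoˡ-≤ ((3 + n) C 2) (s≤s z≤n) ⟩
  (3 + n) + (3 + n) C 2    ≡⟨ cong (_+ (3 + n) C 2) (nC1≡n (3 + n)) ⟨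
  (3 + n) C 1 + (3 + n) C 2 ≡⟨ nCk+nC[k+1]≡[n+1]C[k+1] (3 + n) 1 ⟩
  (4 + n) C 2              ∎
  where open ≤-Reasoning

value-empty : ∀ p n → 3 ≤ n → value {n} (n C 2) p [] ≡ n ∸ finalDeficiency p (n , 0 , 0)
value-empty p n 3≤n = value-closed (n C 2) p [] (empty-represents n)
  (subst (_≤ n C 2) (sym (trans (+-identityʳ (n + 0)) (+-identityʳ n))) (≤-C₂ 3≤n))

-- Stated for s₁ and s₂ themselves: checking the instances n = 3, …, 7 against a statement
-- about value would make Agda evaluate the game tree.
s₁-closed : ∀ n → 3 ≤ n → s₁ n ≡ n ∸ finalDeficiency Max (n , 0 , 0)
s₁-closed = value-empty Max

s₂-closed : ∀ n → 3 ≤ n → s₂ n ≡ n ∸ finalDeficiency Mini (n , 0 , 0)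
s₂-closed = value-empty Mini

finalDeficiency-large : ∀ p j {b} → j % 2 ≡ b → finalDeficiency p (8 + j , 0 , 0) ≡ deficiencyTable p (8 + b) 0 0
finalDeficiency-large p j j%2≡b =
  cong (λ x → deficiencyTable p x 0 0) (trans (reduce-above (m≤m+n 8 j)) (cong (8 +_) j%2≡b))

theorem1p2 :
    (s₁ 1 ≡ 1 ∸ 1 × s₁ 2 ≡ 2 ∸ 2 × s₁ 3 ≡ 3 × s₁ 4 ≡ 4 × s₁ 5 ≡ 5 ∸ 1 × s₁ 6 ≡ 6 × s₁ 7 ≡ 7)
    × (s₂ 1 ≡ 1 ∸ 1 × s₂ 2 ≡ 2 ∸ 2 × s₂ 3 ≡ 3 × s₂ 4 ≡ 4 × s₂ 5 ≡ 5 × s₂ 6 ≡ 6 ∸ 1 × s₂ 7 ≡ 7)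
    × (∀ n → 8 ≤ n →
         -- i = 1: n even (different parity) gives n, n odd (same parity) gives n - 1
         (n % 2 ≡ 0 → s₁ n ≡ n) × (n % 2 ≡ 1 → s₁ n ≡ n ∸ 1)
         -- i = 2: n odd (different parity) gives n, n even (same parity) gives n - 1
         × (n % 2 ≡ 1 → s₂ n ≡ n) × (n % 2 ≡ 0 → s₂ n ≡ n ∸ 1))
theorem1p2 =
    (refl , refl , s₁-closed 3 three≤ , s₁-closed 4 three≤ , s₁-closed 5 three≤ ,
                   s₁-closed 6 three≤ , s₁-closed 7 three≤)
  , (refl , refl , s₂-closed 3 three≤ , s₂-closed 4 three≤ , s₂-closed 5 three≤ ,
                   s₂-closed 6 three≤ , s₂-closed 7 three≤)
  , λ n 8≤n → subst Large (m+[n∸m]≡n 8≤n) (large (n ∸ 8))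
  where
  three≤ : ∀ {k} → 3 ≤ 3 + k
  three≤ = s≤s (s≤s (s≤s z≤n))
  Large : ℕ → Set
  Large n = (n % 2 ≡ 0 → s₁ n ≡ n) × (n % 2 ≡ 1 → s₁ n ≡ n ∸ 1)
          × (n % 2 ≡ 1 → s₂ n ≡ n) × (n % 2 ≡ 0 → s₂ n ≡ n ∸ 1)
  -- (8 + j) % 2 reduces to j % 2.
  large : ∀ j → Large (8 + j)
  large j = (λ even → trans (s₁-closed (8 + j) three≤) (cong (8 + j ∸_) (finalDeficiency-large Max j even)))
          , (λ odd  → trans (s₁-closed (8 + j) three≤) (cong (8 + j ∸_) (finalDeficiency-large Max j odd)))
          , (λ odd  → trans (s₂-closed (8 + j) three≤) (cong (8 + j ∸_) (finalDeficiency-large Mini j odd)))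
          , (λ even → trans (s₂-closed (8 + j) three≤) (cong (8 + j ∸_) (finalDeficiency-large Mini j even)))
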